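{- Let $H_1,\ldots,H_k$ be a sequence of multigraphs on subsets of a common vertex set, each of which is either a cycle or a multigraph consisting of a single doubled edge (two parallel copies of one edge on two vertices). Let $G$ be the multigraph obtained by overlaying them: $V(G)=\bigcup_iV(H_i)$, and each pair has multiplicity in $G$ equal to the sum of its multiplicities in the $H_i$. Let $E_{\mathrm{sing}}$ be the set of edges of $G$ of multiplicity exactly $1$, and let $e(G)$ be the number of edges of $G$ counted with multiplicity. Suppose every connected component of $G$ contains at least one cycle $H_i$. Then \[v(G)-\tfrac12|E_{\mathrm{sing}}|\le\tfrac12\sum_{i=1}^kv(H_i)=\tfrac{e(G)}{2},\] with equality only if every connected component of $G$ can be obtained by first taking one cycle $H_i$ or perfectly overlaying two identical cycles $H_i=H_j$ ($i\neq j$), and then attaching pendant trees made of doubled edges from the sequence (so that removing the cycle portion leaves a forest of doubled edges).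
   Context: $v(\cdot)$ denotes the number of vertices. -}

module Defs where

open import Data.Nat using (ℕ; _≤_; _<_; _+_; _*_)
open import Data.Fin using (Fin)
import Data.Fin.Properties as FinP
open import Data.List using (List; []; _∷_; _∷ʳ_; zip; length; filter; map; allFin; cartesianProduct)
open import Data.List.Relation.Unary.Unique.Propositional using (Unique)
open import Data.List.Relation.Unary.Any using (any?)
open import Data.List.Membership.Propositional using (_∈_; _∉_)
open import Data.Product using (Σ; ∃; _×_; _,_)
open import Data.Sum using (_⊎_)
open import Relation.Binary.PropositionalEquality using (_≡_; _≢_)
open import Relation.Nullary.Decidable using (_×-dec_; _⊎-dec_)
open import Function.Bundles using (_⇔_)
open import Data.Nat.ListAction using (sum)

-- A piece H_i on the common vertex set Fin n: either a cycle given by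
-- its cyclic vertex sequence v0 … v(L-1) (edges {v_j , v_(j+1 mod L)}),
-- or a doubled edge {u , w} (two parallel copies).
data Piece (n : ℕ) : Set where
  cycle : List (Fin n) → Piece n
  dbl   : Fin n → Fin n → Piece n

WF : ∀ {n} → Piece n → Set
WF (cycle vs) = Unique vs × 3 ≤ length vs
WF (dbl u w)  = u ≢ w

IsCycle : ∀ {n} → Piece n → Set
IsCycle (cycle _) = Data.Unit.⊤ where import Data.Unit
IsCycle (dbl _ _) = Data.Empty.⊥ where import Data.Empty

vertsOf : ∀ {n} → Piece n → List (Fin n)
vertsOf (cycle vs) = vs
vertsOf (dbl u w)  = u ∷ w ∷ []

cycEdges : ∀ {n} → List (Fin n) → List (Fin n × Fin n)
cycEdges []       = []
cycEdges (v ∷ vs) = zip (v ∷ vs) (vs ∷ʳ v)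

edgesOf : ∀ {n} → Piece n → List (Fin n × Fin n)
edgesOf (cycle vs) = cycEdges vs
edgesOf (dbl u w)  = (u , w) ∷ (u , w) ∷ []

multH : ∀ {n} → Piece n → Fin n → Fin n → ℕ
multH H a b = length (filter
  (λ e → let (x , y) = e in
     ((x FinP.≟ a) ×-dec (y FinP.≟ b)) ⊎-dec ((x FinP.≟ b) ×-dec (y FinP.≟ a)))
  (edgesOf H))

module Overlay {n k : ℕ} (H : Fin k → Piece n) where

  multG : Fin n → Fin n → ℕ
  multG a b = sum (map (λ i → multH (H i) a b) (allFin k))

  InG : Fin n → Set
  InG x = ∃ λ i → x ∈ vertsOf (H i)

  vG : ℕ
  vG = length (filter (λ x → any? (λ i → x ∈? vertsOf (H i)) (allFin k)) (allFin n))
    where open import Data.List.Membership.DecPropositional FinP._≟_ using (_∈?_)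

  -- unordered pairs {a , b}, a ≠ b, represented as a < b
  pairs : List (Fin n × Fin n)
  pairs = filter (λ p → let (a , b) = p in a FinP.<? b) (cartesianProduct (allFin n) (allFin n))

  eSing : ℕ
  eSing = length (filter (λ p → let (a , b) = p in multG a b Data.Nat.≟ 1) pairs)
    where import Data.Nat

  eG : ℕ
  eG = sum (map (λ p → let (a , b) = p in multG a b) pairs)

  sumV : ℕ
  sumV = sum (map (λ i → length (vertsOf (H i))) (allFin k))

  data Reach : Fin n → Fin n → Set where
    here : ∀ {x} → Reach x x
    step : ∀ {x y z} → 0 < multG x y → Reach y z → Reach x z

  InComp : Fin n → Fin k → Set
  InComp x i = ∃ λ y → y ∈ vertsOf (H i) × Reach x y

  EveryCompHasCycle : Set
  EveryCompHasCycle = ∀ x → InG x → ∃ λ i → IsCycle (H i) × InComp x i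

  Identical : Fin k → Fin k → Set
  Identical i j = (∀ x → (x ∈ vertsOf (H i)) ⇔ (x ∈ vertsOf (H j)))
                × (∀ a b → multH (H i) a b ≡ multH (H j) a b)

  data Core : List (Fin k) → List (Fin n) → Set where
    single  : ∀ c S → H c ≡ cycle S → Core (c ∷ []) S
    doubled : ∀ c c' S → c ≢ c' → H c ≡ cycle S → IsCycle (H c') → Identical c c'
            → Core (c ∷ c' ∷ []) S

  -- attaching pendant trees of doubled edges: starting from the current
  -- vertex set S, each doubled edge H_d = {u , w} in turn joins a vertex of S
  -- to a new vertex, which is then added to S
  data Attach : List (Fin n) → List (Fin k) → Set where
    done : ∀ {S} → Attach S []
    stepL : ∀ {S ds} d u w → H d ≡ dbl u w → u ∈ S → w ∉ S
          → Attach (w ∷ S) ds → Attach S (d ∷ ds)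
    stepR : ∀ {S ds} d u w → H d ≡ dbl u w → w ∈ S → u ∉ S
          → Attach (u ∷ S) ds → Attach S (d ∷ ds)

  CompStructured : Fin n → Set
  CompStructured x = Σ (List (Fin k)) λ cs → Σ (List (Fin n)) λ S → Σ (List (Fin k)) λ ds →
    Core cs S × Attach S ds × (∀ i → InComp x i ⇔ (i ∈ cs ⊎ i ∈ ds))

-- Let D be the set of pairs joined by at least one edge of G. Since 2·[m ≥ 1] ≤ m + [m = 1]
-- for every multiplicity m, summing over all pairs gives 2|D| ≤ e(G) + |E_sing|, and
-- Σ v(H_i) = e(G) because every piece has as many edges as vertices. To get v(G) ≤ |D|,
-- grow each component from one of its cycles: the cycle brings as many distinct edges as
-- vertices, and every further vertex is reached through a new edge.
--
-- In the equality case all these estimates are tight: every multiplicity is at most 2, and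
-- every edge of G at a component is an edge of its starting cycle or of the tree grown from
-- it. A vertex added by the tree is a leaf when added, so another cycle of the component,
-- whose vertices all have two neighbours, lies on the starting cycle; with multiplicities at
-- most 2 it is then identical to it, and a third cycle is impossible. Tree edges are parallel
-- to no cycle edge, hence come from doubled edges, and each doubled edge of the component is
-- such a tree edge.

module Submission where

open import Defs
open import Data.Nat using (ℕ; zero; suc; _≤_; _<_; _+_; _*_; _<?_; z≤n; s≤s)
import Data.Nat as ℕ
open import Data.Nat.Properties
open import Data.Nat.ListAction using (sum)
open import Algebra.Properties.CommutativeSemigroup +-commutativeSemigroup using (interchange; x∙yz≈y∙xz)
open import Data.Fin using (Fin)
import Data.Fin as F
import Data.Fin.Properties as FinP
open import Data.List using (List; []; _∷_; _++_; _∷ʳ_; map; filter; length; zip; allFin; cartesianProduct)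
open import Data.List.Properties using (length-++; length-map; map-++; length-tabulate; filter-some; filter-accept; ++-identityʳ)
open import Data.List.Membership.Propositional using (_∈_; _∉_; lose; find)
open import Data.List.Membership.Propositional.Properties using (∈-filter⁺; ∈-filter⁻; ∈-map⁺; ∈-map⁻; ∈-++⁺ˡ; ∈-++⁺ʳ; ∈-++⁻; ∈-allFin; ∈-cartesianProduct⁺)
open import Data.List.Relation.Unary.Any using (Any; here; there; any?; satisfied)
import Data.List.Relation.Unary.All as All
open import Data.List.Relation.Unary.Unique.Propositional using (Unique; []; _∷_)
import Data.List.Relation.Unary.Unique.Propositional.Properties as Unique
open import Data.List.Relation.Unary.Unique.Propositional.Properties using (Unique[x∷xs]⇒x∉xs)
open import Data.List.Relation.Binary.Subset.Propositional using (_⊆_)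
open import Data.List.Relation.Binary.Disjoint.Propositional using (Disjoint)
open import Data.Product using (∃; ∃₂; _×_; _,_; proj₁; proj₂)
open import Data.Product.Properties using (≡-dec)
open import Data.Sum using (_⊎_; inj₁; inj₂)
open import Data.Empty using (⊥; ⊥-elim)
open import Function using (_∘_; id)
open import Function.Bundles using (_⇔_; mk⇔)
open import Relation.Nullary using (¬_; Dec; yes; no; ¬?; _×-dec_; _⊎-dec_)
open import Relation.Unary using (Pred; Decidable)
open import Relation.Binary.Definitions using (DecidableEquality; tri<; tri≈; tri>)
open import Relation.Binary.PropositionalEquality using (_≡_; _≢_; refl; sym; trans; cong; cong₂; subst; subst₂; module ≡-Reasoning)

-- Lists and sums

indicator : ∀ {p} {P : Set p} → Dec P → ℕ
indicator (yes _) = 1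
indicator (no _)  = 0

module _ {a} {A : Set a} where

  unique-∷ : ∀ {x : A} {xs} → x ∉ xs → Unique xs → Unique (x ∷ xs)
  unique-∷ {x} {xs} x∉xs xs! = All.tabulate (λ y∈xs x≡y → x∉xs (subst (_∈ xs) (sym x≡y) y∈xs)) ∷ xs!

  unique-constant⇒length≡1 : ∀ {xs : List A} {z} → Unique xs → (∀ {y} → y ∈ xs → y ≡ z) → z ∈ xs → length xs ≡ 1
  unique-constant⇒length≡1 {_ ∷ []}     _   _     _ = refl
  unique-constant⇒length≡1 {_ ∷ _ ∷ _} xs! all≡z _ =
    ⊥-elim (Unique[x∷xs]⇒x∉xs xs! (here (trans (all≡z (here refl)) (sym (all≡z (there (here refl)))))))

  length-filter≡sum : ∀ {p} {P : Pred A p} (P? : Decidable P) (xs : List A) →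
    length (filter P? xs) ≡ sum (map (λ x → indicator (P? x)) xs)
  length-filter≡sum P? [] = refl
  length-filter≡sum P? (x ∷ xs) with P? x
  ... | yes _ = cong suc (length-filter≡sum P? xs)
  ... | no _  = length-filter≡sum P? xs

  length≡sum-const : (xs : List A) → length xs ≡ sum (map (λ _ → 1) xs)
  length≡sum-const []       = refl
  length≡sum-const (_ ∷ xs) = cong suc (length≡sum-const xs)

  length-filter-cong : ∀ {p q} {P : Pred A p} {Q : Pred A q} (P? : Decidable P) (Q? : Decidable Q) →
    (∀ {x} → P x → Q x) → (∀ {x} → Q x → P x) → (xs : List A) → length (filter P? xs) ≡ length (filter Q? xs)
  length-filter-cong P? Q? P⇒Q Q⇒P []       = refl
  length-filter-cong P? Q? P⇒Q Q⇒P (x ∷ xs) with P? x | Q? x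
  ... | yes _  | yes _  = cong suc (length-filter-cong P? Q? P⇒Q Q⇒P xs)
  ... | no _   | no _   = length-filter-cong P? Q? P⇒Q Q⇒P xs
  ... | yes px | no ¬qx = ⊥-elim (¬qx (P⇒Q px))
  ... | no ¬px | yes qx = ⊥-elim (¬px (Q⇒P qx))

  length-filter-pos⇒∃ : ∀ {p} {P : Pred A p} (P? : Decidable P) (xs : List A) →
    0 < length (filter P? xs) → ∃ λ x → x ∈ xs × P x
  length-filter-pos⇒∃ P? xs pos with filter P? xs in eq
  ... | y ∷ _ = y , ∈-filter⁻ P? (subst (y ∈_) (sym eq) (here refl))

  sum-map-pos⇒∃ : (f : A → ℕ) (xs : List A) → 0 < sum (map f xs) → ∃ λ x → x ∈ xs × 0 < f x
  sum-map-pos⇒∃ f (x ∷ xs) pos with f x in eq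
  ... | suc _ = x , here refl , subst (0 <_) (sym eq) (s≤s z≤n)
  ... | zero with sum-map-pos⇒∃ f xs pos
  ...   | y , y∈xs , fy>0 = y , there y∈xs , fy>0

  sum-map-+ : (f g : A → ℕ) (xs : List A) → sum (map (λ x → f x + g x) xs) ≡ sum (map f xs) + sum (map g xs)
  sum-map-+ f g []       = refl
  sum-map-+ f g (x ∷ xs) = begin
    (f x + g x) + sum (map (λ x → f x + g x) xs)    ≡⟨ cong (f x + g x +_) (sum-map-+ f g xs) ⟩
    (f x + g x) + (sum (map f xs) + sum (map g xs)) ≡⟨ interchange (f x) (g x) _ _ ⟩
    (f x + sum (map f xs)) + (g x + sum (map g xs)) ∎
    where open ≡-Reasoning

  sum-map-cong : (f g : A → ℕ) (xs : List A) → (∀ {x} → x ∈ xs → f x ≡ g x) → sum (map f xs) ≡ sum (map g xs)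
  sum-map-cong f g []       f≡g = refl
  sum-map-cong f g (x ∷ xs) f≡g = cong₂ _+_ (f≡g (here refl)) (sum-map-cong f g xs (f≡g ∘ there))

  sum-map-mono : (f g : A → ℕ) (xs : List A) → (∀ {x} → x ∈ xs → f x ≤ g x) → sum (map f xs) ≤ sum (map g xs)
  sum-map-mono f g []       f≤g = z≤n
  sum-map-mono f g (x ∷ xs) f≤g = +-mono-≤ (f≤g (here refl)) (sum-map-mono f g xs (f≤g ∘ there))

  sum-map-mono-tight : (f g : A → ℕ) (xs : List A) → (∀ {x} → x ∈ xs → f x ≤ g x) →
    sum (map g xs) ≤ sum (map f xs) → ∀ {x} → x ∈ xs → g x ≤ f x
  sum-map-mono-tight f g (y ∷ xs) f≤g Σg≤Σf (here refl) =
    +-cancelʳ-≤ (sum (map g xs)) (g y) (f y)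
      (≤-trans Σg≤Σf (+-monoʳ-≤ (f y) (sum-map-mono f g xs (f≤g ∘ there))))
  sum-map-mono-tight f g (y ∷ xs) f≤g Σg≤Σf (there x∈xs) =
    sum-map-mono-tight f g xs (f≤g ∘ there)
      (+-cancelˡ-≤ (f y) _ _ (≤-trans (+-monoˡ-≤ (sum (map g xs)) (f≤g (here refl))) Σg≤Σf)) x∈xs

module _ {a b} {A : Set a} {B : Set b} where

  sum-map-comm : (g : A → B → ℕ) (xs : List A) (ys : List B) →
    sum (map (λ x → sum (map (g x) ys)) xs) ≡ sum (map (λ y → sum (map (λ x → g x y) xs)) ys)
  sum-map-comm g []       ys = sym (sum-map-zero ys)
    where
      sum-map-zero : (ys : List B) → sum (map (λ _ → 0) ys) ≡ 0
      sum-map-zero []       = refl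
      sum-map-zero (_ ∷ ys) = sum-map-zero ys
  sum-map-comm g (x ∷ xs) ys = begin
    sum (map (g x) ys) + sum (map (λ x → sum (map (g x) ys)) xs)
      ≡⟨ cong (sum (map (g x) ys) +_) (sum-map-comm g xs ys) ⟩
    sum (map (g x) ys) + sum (map (λ y → sum (map (λ x → g x y) xs)) ys)
      ≡⟨ sum-map-+ (g x) (λ y → sum (map (λ x → g x y) xs)) ys ⟨
    sum (map (λ y → g x y + sum (map (λ x → g x y) xs)) ys) ∎
    where open ≡-Reasoning

  unique-map⇒injective : ∀ (f : A → B) {xs} → Unique (map f xs) →
    ∀ {x y} → x ∈ xs → y ∈ xs → f x ≡ f y → x ≡ y
  unique-map⇒injective f fxs! (here refl) (here refl) _ = refl
  unique-map⇒injective f {_ ∷ xs} fxs! (here refl) (there y∈) fx≡fy =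
    ⊥-elim (Unique[x∷xs]⇒x∉xs fxs! (subst (_∈ map f xs) (sym fx≡fy) (∈-map⁺ f y∈)))
  unique-map⇒injective f {_ ∷ xs} fxs! (there x∈) (here refl) fx≡fy =
    ⊥-elim (Unique[x∷xs]⇒x∉xs fxs! (subst (_∈ map f xs) fx≡fy (∈-map⁺ f x∈)))
  unique-map⇒injective f (_ ∷ fxs!) (there x∈) (there y∈) fx≡fy = unique-map⇒injective f fxs! x∈ y∈ fx≡fy

module _ {a} {A : Set a} (_≟_ : DecidableEquality A) where

  open import Data.List.Membership.DecPropositional _≟_ using (_∈?_)

  private
    remove : A → List A → List A
    remove x []       = []
    remove x (y ∷ ys) with y ≟ x
    ... | yes _ = ys
    ... | no _  = y ∷ remove x ys

    sum-remove : (f : A → ℕ) {x : A} {ys : List A} → x ∈ ys → sum (map f ys) ≡ f x + sum (map f (remove x ys))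
    sum-remove f {x} {y ∷ ys} x∈ys with y ≟ x
    sum-remove f {x} {y ∷ ys} x∈ys         | yes refl = refl
    sum-remove f {x} {y ∷ ys} (here refl)  | no y≢x   = ⊥-elim (y≢x refl)
    sum-remove f {x} {y ∷ ys} (there x∈ys) | no _     = begin
      f y + sum (map f ys)                       ≡⟨ cong (f y +_) (sum-remove f x∈ys) ⟩
      f y + (f x + sum (map f (remove x ys)))    ≡⟨ x∙yz≈y∙xz (f y) (f x) _ ⟩
      f x + (f y + sum (map f (remove x ys)))    ∎
      where open ≡-Reasoning

    ∈-remove : ∀ {x z : A} {ys} → z ∈ ys → z ≢ x → z ∈ remove x ys
    ∈-remove {x} {z} {y ∷ ys} z∈ys z≢x with y ≟ x
    ∈-remove (here refl)  z≢x | yes refl = ⊥-elim (z≢x refl)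
    ∈-remove (there z∈ys) z≢x | yes refl = z∈ys
    ∈-remove (here refl)  z≢x | no _     = here refl
    ∈-remove (there z∈ys) z≢x | no _     = there (∈-remove z∈ys z≢x)

  sum-map-mono-⊆ : (f : A → ℕ) {xs ys : List A} → Unique xs → xs ⊆ ys → sum (map f xs) ≤ sum (map f ys)
  sum-map-mono-⊆ f {[]}     _            _     = z≤n
  sum-map-mono-⊆ f {x ∷ xs} {ys} (x∉xs ∷ xs!) xs⊆ys = begin
    f x + sum (map f xs)            ≤⟨ +-monoʳ-≤ (f x) (sum-map-mono-⊆ f xs! xs⊆ys-x) ⟩
    f x + sum (map f (remove x ys)) ≡⟨ sum-remove f (xs⊆ys (here refl)) ⟨
    sum (map f ys)                  ∎
    where
      open ≤-Reasoning
      xs⊆ys-x : xs ⊆ remove x ys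
      xs⊆ys-x z∈xs = ∈-remove (xs⊆ys (there z∈xs)) (λ { refl → All.lookup x∉xs z∈xs refl })

  length-mono-⊆ : {xs ys : List A} → Unique xs → xs ⊆ ys → length xs ≤ length ys
  length-mono-⊆ {xs} {ys} xs! xs⊆ys = begin
    length xs                 ≡⟨ length≡sum-const xs ⟩
    sum (map (λ _ → 1) xs)    ≤⟨ sum-map-mono-⊆ (λ _ → 1) xs! xs⊆ys ⟩
    sum (map (λ _ → 1) ys)    ≡⟨ length≡sum-const ys ⟨
    length ys                 ∎
    where open ≤-Reasoning

  ⊆-length-≥⇒⊇ : ∀ {xs ys : List A} → Unique xs → xs ⊆ ys → length ys ≤ length xs → ys ⊆ xs
  ⊆-length-≥⇒⊇ {xs} {ys} xs! xs⊆ys |ys|≤|xs| {y} y∈ys with y ∈? xs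
  ... | yes y∈xs = y∈xs
  ... | no y∉xs  = ⊥-elim (<⇒≱ (length-mono-⊆ (unique-∷ y∉xs xs!) y∷xs⊆ys) |ys|≤|xs|)
    where
      y∷xs⊆ys : y ∷ xs ⊆ ys
      y∷xs⊆ys (here refl) = y∈ys
      y∷xs⊆ys (there z∈)  = xs⊆ys z∈

-- Paths, cycles and unordered pairs

module _ {a} {A : Set a} where

  pathEdges : List A → List (A × A)
  pathEdges []           = []
  pathEdges (x ∷ [])     = []
  pathEdges (x ∷ y ∷ zs) = (x , y) ∷ pathEdges (y ∷ zs)

  lastOf : A → List A → A
  lastOf x []       = x
  lastOf _ (y ∷ ys) = lastOf y ys

  lastOf-∈ : ∀ x ys → lastOf x ys ∈ x ∷ ys
  lastOf-∈ x []       = here refl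
  lastOf-∈ x (y ∷ ys) = there (lastOf-∈ y ys)

  length-pathEdges : ∀ x ys → length (pathEdges (x ∷ ys)) ≡ length ys
  length-pathEdges x []       = refl
  length-pathEdges x (y ∷ ys) = cong suc (length-pathEdges y ys)

  ∈-pathEdges⇒∈₁ : ∀ {xs a b} → (a , b) ∈ pathEdges xs → a ∈ xs
  ∈-pathEdges⇒∈₁ {x ∷ y ∷ zs} (here refl) = here refl
  ∈-pathEdges⇒∈₁ {x ∷ y ∷ zs} (there e∈) = there (∈-pathEdges⇒∈₁ e∈)

  ∈-pathEdges⇒∈₂ : ∀ {x ys a b} → (a , b) ∈ pathEdges (x ∷ ys) → b ∈ ys
  ∈-pathEdges⇒∈₂ {x} {y ∷ zs} (here refl) = here refl
  ∈-pathEdges⇒∈₂ {x} {y ∷ zs} (there e∈) = there (∈-pathEdges⇒∈₂ e∈)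

  pathEdges-irrefl : ∀ {xs a b} → Unique xs → (a , b) ∈ pathEdges xs → a ≢ b
  pathEdges-irrefl {x ∷ y ∷ zs} xs!       (here refl) refl = Unique[x∷xs]⇒x∉xs xs! (here refl)
  pathEdges-irrefl {x ∷ y ∷ zs} (_ ∷ xs!) (there e∈) = pathEdges-irrefl xs! e∈

  pathEdges-∉lastOf : ∀ {x ys a b} → Unique (x ∷ ys) → (a , b) ∈ pathEdges (x ∷ ys) → a ≢ lastOf x ys
  pathEdges-∉lastOf {x} {y ∷ zs} xs! (here refl) refl = Unique[x∷xs]⇒x∉xs xs! (lastOf-∈ y zs)
  pathEdges-∉lastOf {x} {y ∷ zs} (_ ∷ xs!) (there e∈) = pathEdges-∉lastOf xs! e∈

  pathEdges-succ-unique : ∀ {xs a b c} → Unique xs → (a , b) ∈ pathEdges xs → (a , c) ∈ pathEdges xs → b ≡ c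
  pathEdges-succ-unique {x ∷ y ∷ zs} xs!       (here refl) (here refl) = refl
  pathEdges-succ-unique {x ∷ y ∷ zs} xs!       (here refl) (there e∈)  = ⊥-elim (Unique[x∷xs]⇒x∉xs xs! (∈-pathEdges⇒∈₁ e∈))
  pathEdges-succ-unique {x ∷ y ∷ zs} xs!       (there e∈)  (here refl) = ⊥-elim (Unique[x∷xs]⇒x∉xs xs! (∈-pathEdges⇒∈₁ e∈))
  pathEdges-succ-unique {x ∷ y ∷ zs} (_ ∷ xs!) (there e∈)  (there e∈′) = pathEdges-succ-unique xs! e∈ e∈′

  pathEdges-pred-unique : ∀ {xs a b c} → Unique xs → (a , c) ∈ pathEdges xs → (b , c) ∈ pathEdges xs → a ≡ b
  pathEdges-pred-unique {x ∷ y ∷ zs} xs!       (here refl) (here refl) = refl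
  pathEdges-pred-unique {x ∷ y ∷ zs} (_ ∷ ys!) (here refl) (there e∈)  = ⊥-elim (Unique[x∷xs]⇒x∉xs ys! (∈-pathEdges⇒∈₂ e∈))
  pathEdges-pred-unique {x ∷ y ∷ zs} (_ ∷ ys!) (there e∈)  (here refl) = ⊥-elim (Unique[x∷xs]⇒x∉xs ys! (∈-pathEdges⇒∈₂ e∈))
  pathEdges-pred-unique {x ∷ y ∷ zs} (_ ∷ ys!) (there e∈)  (there e∈′) = pathEdges-pred-unique ys! e∈ e∈′

  pathEdges-pred : ∀ {x ys b} → b ∈ ys → ∃ λ a → (a , b) ∈ pathEdges (x ∷ ys)
  pathEdges-pred {x} {y ∷ zs} (here refl) = x , here refl
  pathEdges-pred {x} {y ∷ zs} (there b∈)  with pathEdges-pred {y} b∈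
  ... | a , e∈ = a , there e∈

  pathEdges-succ-or-last : ∀ {x ys a} → a ∈ x ∷ ys → (∃ λ b → (a , b) ∈ pathEdges (x ∷ ys)) ⊎ a ≡ lastOf x ys
  pathEdges-succ-or-last {x} {[]}     (here refl) = inj₂ refl
  pathEdges-succ-or-last {x} {y ∷ zs} (here refl) = inj₁ (y , here refl)
  pathEdges-succ-or-last {x} {y ∷ zs} (there a∈) with pathEdges-succ-or-last {y} {zs} a∈
  ... | inj₁ (b , e∈) = inj₁ (b , there e∈)
  ... | inj₂ a≡last   = inj₂ a≡last

  module _ {p} (T : A → Set p) where

    pathEdges-transport-back : ∀ x ys → (∀ {a b} → (a , b) ∈ pathEdges (x ∷ ys) → T b → T a) →
      ∀ {a} → a ∈ x ∷ ys → T a → T x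
    pathEdges-transport-back x ys       step (here refl) Ta = Ta
    pathEdges-transport-back x (y ∷ zs) step (there a∈) Ta =
      step (here refl) (pathEdges-transport-back y zs (step ∘ there) a∈ Ta)

    pathEdges-transport : ∀ x ys → (∀ {a b} → (a , b) ∈ pathEdges (x ∷ ys) → T a → T b) →
      T x → ∀ {a} → a ∈ x ∷ ys → T a
    pathEdges-transport x ys       step Tx (here refl) = Tx
    pathEdges-transport x (y ∷ zs) step Tx (there a∈) =
      pathEdges-transport y zs (step ∘ there) (step (here refl) Tx) a∈

  _≈ₑ_ : A × A → A × A → Set a
  (a , b) ≈ₑ (c , d) = (a ≡ c × b ≡ d) ⊎ (a ≡ d × b ≡ c)

  ≈ₑ-refl : ∀ {e} → e ≈ₑ e
  ≈ₑ-refl = inj₁ (refl , refl)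

  ≈ₑ-swap : ∀ {a b} → (a , b) ≈ₑ (b , a)
  ≈ₑ-swap = inj₂ (refl , refl)

  ≈ₑ-sym : ∀ {e f} → e ≈ₑ f → f ≈ₑ e
  ≈ₑ-sym (inj₁ (refl , refl)) = ≈ₑ-refl
  ≈ₑ-sym (inj₂ (refl , refl)) = ≈ₑ-swap

  ≈ₑ-trans : ∀ {e f g} → e ≈ₑ f → f ≈ₑ g → e ≈ₑ g
  ≈ₑ-trans (inj₁ (refl , refl)) f≈g = f≈g
  ≈ₑ-trans (inj₂ (refl , refl)) (inj₁ (refl , refl)) = ≈ₑ-swap
  ≈ₑ-trans (inj₂ (refl , refl)) (inj₂ (refl , refl)) = ≈ₑ-refl

  ≈ₑ-endpoints : ∀ {p} {P : A → Set p} {e f} → e ≈ₑ f →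
    P (proj₁ f) × P (proj₂ f) → P (proj₁ e) × P (proj₂ e)
  ≈ₑ-endpoints (inj₁ (refl , refl)) (Pc , Pd) = Pc , Pd
  ≈ₑ-endpoints (inj₂ (refl , refl)) (Pc , Pd) = Pd , Pc

module _ {n : ℕ} where

  private
    V : Set
    V = Fin n

  -- The test used in Defs.multH, so multH P a b is definitionally length (filter (_≈ₑ? (a , b)) (edgesOf P)).
  _≈ₑ?_ : (e f : V × V) → Dec (e ≈ₑ f)
  (a , b) ≈ₑ? (c , d) = ((a FinP.≟ c) ×-dec (b FinP.≟ d)) ⊎-dec ((a FinP.≟ d) ×-dec (b FinP.≟ c))

  canon : V × V → V × V
  canon (a , b) with a FinP.<? b
  ... | yes _ = a , b
  ... | no _  = b , a

  canon-≈ₑ : ∀ e → canon e ≈ₑ e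
  canon-≈ₑ (a , b) with a FinP.<? b
  ... | yes _ = ≈ₑ-refl
  ... | no _  = ≈ₑ-swap

  canon-< : ∀ {a b} → a ≢ b → proj₁ (canon (a , b)) F.< proj₂ (canon (a , b))
  canon-< {a} {b} a≢b with a FinP.<? b
  ... | yes a<b = a<b
  ... | no a≮b with FinP.<-cmp a b
  ...   | tri< a<b _   _   = ⊥-elim (a≮b a<b)
  ...   | tri≈ _   a≡b _   = ⊥-elim (a≢b a≡b)
  ...   | tri> _   _   b<a = b<a

  canon-fixed : ∀ {a b} → a F.< b → canon (a , b) ≡ (a , b)
  canon-fixed {a} {b} a<b with a FinP.<? b
  ... | yes _   = refl
  ... | no a≮b = ⊥-elim (a≮b a<b)

  canon-≡⇒≈ₑ : ∀ {e f} → canon e ≡ canon f → e ≈ₑ f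
  canon-≡⇒≈ₑ {e} {f} eq = ≈ₑ-trans (≈ₑ-sym (canon-≈ₑ e)) (subst (_≈ₑ f) (sym eq) (canon-≈ₑ f))

  ≈ₑ⇒canon-≡ : ∀ {e f} → e ≈ₑ f → canon e ≡ canon f
  ≈ₑ⇒canon-≡ (inj₁ (refl , refl)) = refl
  ≈ₑ⇒canon-≡ {a , b} (inj₂ (refl , refl)) with a FinP.<? b | b FinP.<? a
  ... | yes a<b | yes b<a = ⊥-elim (FinP.<-asym a<b b<a)
  ... | yes _   | no _    = refl
  ... | no _    | yes _   = refl
  ... | no a≮b  | no b≮a with FinP.<-cmp a b
  ...   | tri< a<b _    _   = ⊥-elim (a≮b a<b)
  ...   | tri≈ _   refl _   = refl
  ...   | tri> _   _    b<a = ⊥-elim (b≮a b<a)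

  cycEdges-split : (v : V) (t : List V) → cycEdges (v ∷ t) ≡ pathEdges (v ∷ t) ++ (lastOf v t , v) ∷ []
  cycEdges-split v t = zip-snoc v t
    where
      zip-snoc : ∀ x ys {w} → zip (x ∷ ys) (ys ∷ʳ w) ≡ pathEdges (x ∷ ys) ++ (lastOf x ys , w) ∷ []
      zip-snoc x []       = refl
      zip-snoc x (y ∷ ys) = cong ((x , y) ∷_) (zip-snoc y ys)

  ∈-cycEdges⁻ : (v : V) (t : List V) → ∀ {e} → e ∈ cycEdges (v ∷ t) → e ∈ pathEdges (v ∷ t) ⊎ e ≡ (lastOf v t , v)
  ∈-cycEdges⁻ v t e∈ with ∈-++⁻ (pathEdges (v ∷ t)) (subst (_ ∈_) (cycEdges-split v t) e∈)
  ... | inj₁ e∈path       = inj₁ e∈path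
  ... | inj₂ (here e≡) = inj₂ e≡

  ∈-pathEdges⇒∈-cycEdges : ∀ {v : V} {t e} → e ∈ pathEdges (v ∷ t) → e ∈ cycEdges (v ∷ t)
  ∈-pathEdges⇒∈-cycEdges {v} {t} e∈ = subst (_ ∈_) (sym (cycEdges-split v t)) (∈-++⁺ˡ e∈)

  closing-∈-cycEdges : (v : V) (t : List V) → (lastOf v t , v) ∈ cycEdges (v ∷ t)
  closing-∈-cycEdges v t = subst ((lastOf v t , v) ∈_) (sym (cycEdges-split v t)) (∈-++⁺ʳ (pathEdges (v ∷ t)) (here refl))

  length-cycEdges : (vs : List V) → length (cycEdges vs) ≡ length vs
  length-cycEdges []      = refl
  length-cycEdges (v ∷ t) = begin
    length (cycEdges (v ∷ t))                                ≡⟨ cong length (cycEdges-split v t) ⟩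
    length (pathEdges (v ∷ t) ++ (lastOf v t , v) ∷ [])      ≡⟨ length-++ (pathEdges (v ∷ t)) ⟩
    length (pathEdges (v ∷ t)) + 1                           ≡⟨ cong (_+ 1) (length-pathEdges v t) ⟩
    length t + 1                                             ≡⟨ +-comm (length t) 1 ⟩
    suc (length t)                                           ∎
    where open ≡-Reasoning

  ∈-cycEdges⇒∈₁ : ∀ {vs : List V} {a b} → (a , b) ∈ cycEdges vs → a ∈ vs
  ∈-cycEdges⇒∈₁ {v ∷ t} e∈ with ∈-cycEdges⁻ v t e∈
  ... | inj₁ e∈path = ∈-pathEdges⇒∈₁ e∈path
  ... | inj₂ refl   = lastOf-∈ v t

  ∈-cycEdges⇒∈₂ : ∀ {vs : List V} {a b} → (a , b) ∈ cycEdges vs → b ∈ vs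
  ∈-cycEdges⇒∈₂ {v ∷ t} e∈ with ∈-cycEdges⁻ v t e∈
  ... | inj₁ e∈path = there (∈-pathEdges⇒∈₂ e∈path)
  ... | inj₂ refl   = here refl

  cycEdges-irrefl : ∀ {vs : List V} {a b} → Unique vs → 2 ≤ length vs → (a , b) ∈ cycEdges vs → a ≢ b
  cycEdges-irrefl {v ∷ []}     _   (s≤s ())
  cycEdges-irrefl {v ∷ y ∷ zs} vs! _ e∈ with ∈-cycEdges⁻ v (y ∷ zs) e∈
  ... | inj₁ e∈path = pathEdges-irrefl vs! e∈path
  ... | inj₂ refl   = λ last≡v → Unique[x∷xs]⇒x∉xs vs! (subst (_∈ y ∷ zs) last≡v (lastOf-∈ y zs))

  cycEdges-succ-unique : ∀ {vs a b c} → Unique vs → (a , b) ∈ cycEdges vs → (a , c) ∈ cycEdges vs → b ≡ c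
  cycEdges-succ-unique {v ∷ t} vs! e∈ e∈′ with ∈-cycEdges⁻ v t e∈ | ∈-cycEdges⁻ v t e∈′
  ... | inj₁ p | inj₁ p′  = pathEdges-succ-unique vs! p p′
  ... | inj₁ p | inj₂ refl = ⊥-elim (pathEdges-∉lastOf vs! p refl)
  ... | inj₂ refl | inj₁ p′ = ⊥-elim (pathEdges-∉lastOf vs! p′ refl)
  ... | inj₂ refl | inj₂ refl = refl

  cycEdges-pred-unique : ∀ {vs a b c} → Unique vs → (a , c) ∈ cycEdges vs → (b , c) ∈ cycEdges vs → a ≡ b
  cycEdges-pred-unique {v ∷ t} vs! e∈ e∈′ with ∈-cycEdges⁻ v t e∈ | ∈-cycEdges⁻ v t e∈′
  ... | inj₁ p | inj₁ p′  = pathEdges-pred-unique vs! p p′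
  ... | inj₁ p | inj₂ refl = ⊥-elim (Unique[x∷xs]⇒x∉xs vs! (∈-pathEdges⇒∈₂ p))
  ... | inj₂ refl | inj₁ p′ = ⊥-elim (Unique[x∷xs]⇒x∉xs vs! (∈-pathEdges⇒∈₂ p′))
  ... | inj₂ refl | inj₂ refl = refl

  cycEdges-succ : ∀ {vs : List V} {a} → a ∈ vs → ∃ λ b → (a , b) ∈ cycEdges vs
  cycEdges-succ {v ∷ t} a∈ with pathEdges-succ-or-last a∈
  ... | inj₁ (b , e∈) = b , ∈-pathEdges⇒∈-cycEdges e∈
  ... | inj₂ refl     = v , closing-∈-cycEdges v t

  cycEdges-pred : ∀ {vs : List V} {a} → a ∈ vs → ∃ λ b → (b , a) ∈ cycEdges vs
  cycEdges-pred {v ∷ t} (here refl) = lastOf v t , closing-∈-cycEdges v t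
  cycEdges-pred {v ∷ t} (there a∈) with pathEdges-pred {x = v} a∈
  ... | b , e∈ = b , ∈-pathEdges⇒∈-cycEdges e∈

  cycEdges-transport : ∀ {p} (T : V → Set p) {vs} →
    (∀ {a b} → (a , b) ∈ cycEdges vs → (T a → T b) × (T b → T a)) →
    ∀ {a b} → a ∈ vs → b ∈ vs → T a → T b
  cycEdges-transport T {v ∷ t} step a∈ b∈ Ta =
    pathEdges-transport T v t (λ e∈ → proj₁ (step (∈-pathEdges⇒∈-cycEdges e∈)))
      (pathEdges-transport-back T v t (λ e∈ → proj₂ (step (∈-pathEdges⇒∈-cycEdges e∈))) a∈ Ta) b∈

  pathEdges-canon-unique : ∀ {xs : List V} → Unique xs → Unique (map canon (pathEdges xs))
  pathEdges-canon-unique {[]}         _ = []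
  pathEdges-canon-unique {x ∷ []}     _ = []
  pathEdges-canon-unique {x ∷ y ∷ zs} xs!@(_ ∷ ys!) = unique-∷ fresh (pathEdges-canon-unique ys!)
    where
      fresh : canon (x , y) ∉ map canon (pathEdges (y ∷ zs))
      fresh c∈ with ∈-map⁻ canon c∈
      ... | (a , b) , e∈ , c≡ with canon-≡⇒≈ₑ c≡
      ...   | inj₁ (refl , _) = Unique[x∷xs]⇒x∉xs xs! (∈-pathEdges⇒∈₁ e∈)
      ...   | inj₂ (refl , _) = Unique[x∷xs]⇒x∉xs xs! (there (∈-pathEdges⇒∈₂ e∈))

  cycEdges-canon-unique : ∀ {vs : List V} → Unique vs → 3 ≤ length vs → Unique (map canon (cycEdges vs))
  cycEdges-canon-unique {v ∷ t} vs! len≥3 rewrite cycEdges-split v t | map-++ canon (pathEdges (v ∷ t)) ((lastOf v t , v) ∷ []) =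
    Unique.++⁺ (pathEdges-canon-unique vs!) (unique-∷ (λ ()) []) closing-fresh
    where
      closing-fresh : Disjoint (map canon (pathEdges (v ∷ t))) (canon (lastOf v t , v) ∷ [])
      closing-fresh (c∈ , here c≡) with ∈-map⁻ canon c∈
      ... | (a , b) , e∈ , c≡′ with canon-≡⇒≈ₑ (trans (sym c≡′) c≡)
      ...   | inj₁ (_ , refl) = Unique[x∷xs]⇒x∉xs vs! (∈-pathEdges⇒∈₂ e∈)
      ...   | inj₂ (refl , b≡last) = opposite t len≥3 vs! e∈ (sym b≡last)
        where
          opposite : ∀ t → 3 ≤ length (v ∷ t) → Unique (v ∷ t) → ∀ {b} → (v , b) ∈ pathEdges (v ∷ t) → lastOf v t ≢ b
          opposite (x ∷ y ∷ r) _ (_ ∷ ys!) (here refl) last≡ =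
            Unique[x∷xs]⇒x∉xs ys! (subst (_∈ y ∷ r) last≡ (lastOf-∈ y r))
          opposite (x ∷ y ∷ r) _ vs! (there e∈) _ = Unique[x∷xs]⇒x∉xs vs! (∈-pathEdges⇒∈₁ e∈)
          opposite (x ∷ []) (s≤s (s≤s ())) _ _ _

  cycEdges-two-neighbours : ∀ {vs : List V} {a} → Unique vs → 3 ≤ length vs → a ∈ vs →
    ∃₂ λ q₁ q₂ → q₁ ≢ q₂ × (a , q₁) ∈ cycEdges vs × (q₂ , a) ∈ cycEdges vs
  cycEdges-two-neighbours vs! len≥3 a∈ with cycEdges-succ a∈ | cycEdges-pred a∈
  ... | q₁ , e₁∈ | q₂ , e₂∈ = q₁ , q₂ , distinct , e₁∈ , e₂∈
    where
      distinct : q₁ ≢ q₂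
      distinct refl with unique-map⇒injective canon (cycEdges-canon-unique vs! len≥3) e₁∈ e₂∈ (≈ₑ⇒canon-≡ ≈ₑ-swap)
      ... | refl = cycEdges-irrefl vs! (≤-trans (n≤1+n 2) len≥3) e₁∈ refl

  Adjacent : List (V × V) → V → V → Set
  Adjacent es a b = (a , b) ∈ es ⊎ (b , a) ∈ es

  Adjacent-sym : ∀ {es a b} → Adjacent es a b → Adjacent es b a
  Adjacent-sym (inj₁ e∈) = inj₂ e∈
  Adjacent-sym (inj₂ e∈) = inj₁ e∈

  cycEdges-at-most-two-neighbours : ∀ {vs : List V} {a q₁ q₂ q₃} → Unique vs →
    Adjacent (cycEdges vs) a q₁ → Adjacent (cycEdges vs) a q₂ → Adjacent (cycEdges vs) a q₃ →
    q₁ ≢ q₂ → q₃ ≡ q₁ ⊎ q₃ ≡ q₂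
  cycEdges-at-most-two-neighbours vs! (inj₁ e₁) (inj₁ e₂) _ q₁≢q₂ = ⊥-elim (q₁≢q₂ (cycEdges-succ-unique vs! e₁ e₂))
  cycEdges-at-most-two-neighbours vs! (inj₂ e₁) (inj₂ e₂) _ q₁≢q₂ = ⊥-elim (q₁≢q₂ (cycEdges-pred-unique vs! e₁ e₂))
  cycEdges-at-most-two-neighbours vs! (inj₁ e₁) (inj₂ e₂) (inj₁ e₃) _ = inj₁ (cycEdges-succ-unique vs! e₃ e₁)
  cycEdges-at-most-two-neighbours vs! (inj₁ e₁) (inj₂ e₂) (inj₂ e₃) _ = inj₂ (cycEdges-pred-unique vs! e₃ e₂)
  cycEdges-at-most-two-neighbours vs! (inj₂ e₁) (inj₁ e₂) (inj₁ e₃) _ = inj₂ (cycEdges-succ-unique vs! e₃ e₂)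
  cycEdges-at-most-two-neighbours vs! (inj₂ e₁) (inj₁ e₂) (inj₂ e₃) _ = inj₁ (cycEdges-pred-unique vs! e₃ e₁)

-- The overlay graph

module _ {n : ℕ} where

  unique-length≥n⇒∈ : ∀ {S : List (Fin n)} → Unique S → n ≤ length S → ∀ z → z ∈ S
  unique-length≥n⇒∈ S! len≥n z = ⊆-length-≥⇒⊇ FinP._≟_ S! (λ _ → ∈-allFin _)
    (≤-trans (≤-reflexive (length-tabulate id)) len≥n) (∈-allFin z)

  piece-view : ∀ (P : Piece n) → (∃ λ ws → P ≡ cycle ws) ⊎ (∃₂ λ p q → P ≡ dbl p q)
  piece-view (cycle ws) = inj₁ (ws , refl)
  piece-view (dbl p q)  = inj₂ (p , q , refl)

  cycle-view : ∀ (P : Piece n) → IsCycle P → ∃ λ ws → P ≡ cycle ws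
  cycle-view (cycle ws) _ = ws , refl

  IsCycle? : ∀ (P : Piece n) → Dec (IsCycle P)
  IsCycle? (cycle _) = yes _
  IsCycle? (dbl _ _) = no λ ()

  multH-pos : ∀ (P : Piece n) {a b e} → e ∈ edgesOf P → e ≈ₑ (a , b) → 0 < multH P a b
  multH-pos P e∈ e≈ = filter-some (_≈ₑ? _) (lose e∈ e≈)

  multH-pos⇒∃ : ∀ (P : Piece n) {a b} → 0 < multH P a b → ∃ λ e → e ∈ edgesOf P × e ≈ₑ (a , b)
  multH-pos⇒∃ P = length-filter-pos⇒∃ (_≈ₑ? _) (edgesOf P)

  multH-sym : ∀ (P : Piece n) a b → multH P a b ≡ multH P b a
  multH-sym P a b = length-filter-cong (_≈ₑ? _) (_≈ₑ? _) (λ e≈ → ≈ₑ-trans e≈ ≈ₑ-swap) (λ e≈ → ≈ₑ-trans e≈ ≈ₑ-swap) (edgesOf P)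

  multH-dbl : ∀ {u w a b : Fin n} → (u , w) ≈ₑ (a , b) → multH (dbl u w) a b ≡ 2
  multH-dbl {u} {w} {a} {b} uw≈ab =
    cong length (trans (filter-accept (_≈ₑ? (a , b)) uw≈ab) (cong ((u , w) ∷_) (filter-accept (_≈ₑ? (a , b)) uw≈ab)))

module Graph {n k : ℕ} (H : Fin k → Piece n) (wf : ∀ i → WF (H i)) where

  open Overlay H public
  open import Data.List.Membership.DecPropositional (FinP._≟_ {n}) public using (_∈?_)

  private
    V : Set
    V = Fin n

  multG-sym : ∀ a b → multG a b ≡ multG b a
  multG-sym a b = sum-map-cong _ _ (allFin k) (λ {i} _ → multH-sym (H i) a b)

  sum-multH≤multG : ∀ {is} → Unique is → ∀ a b → sum (map (λ i → multH (H i) a b) is) ≤ multG a b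
  sum-multH≤multG is! a b = sum-map-mono-⊆ FinP._≟_ (λ i → multH (H i) a b) is! (λ _ → ∈-allFin _)

  multG-pos⇒∃ : ∀ {a b} → 0 < multG a b → ∃ λ i → 0 < multH (H i) a b
  multG-pos⇒∃ {a} {b} pos with sum-map-pos⇒∃ (λ i → multH (H i) a b) (allFin k) pos
  ... | i , _ , multHᵢ>0 = i , multHᵢ>0

  Adj : V → V → Set
  Adj a b = 0 < multG a b

  Adj? : ∀ a b → Dec (Adj a b)
  Adj? a b = 0 <? multG a b

  Adj-sym : ∀ {a b} → Adj a b → Adj b a
  Adj-sym {a} {b} = subst (0 <_) (multG-sym a b)

  multH≤multG : ∀ i a b → multH (H i) a b ≤ multG a b
  multH≤multG i a b = ≤-trans (≤-reflexive (sym (+-identityʳ _))) (sum-multH≤multG (unique-∷ (λ ()) []) a b)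

  multH+multH≤multG : ∀ {i j} → i ≢ j → ∀ a b → multH (H i) a b + multH (H j) a b ≤ multG a b
  multH+multH≤multG {i} {j} i≢j a b = ≤-trans (≤-reflexive (cong (multH (H i) a b +_) (sym (+-identityʳ _))))
    (sum-multH≤multG (unique-∷ (λ { (here i≡j) → i≢j i≡j ; (there ()) }) (unique-∷ (λ ()) [])) a b)

  edgesOf⇒Adj : ∀ i {a b} → (a , b) ∈ edgesOf (H i) → Adj a b
  edgesOf⇒Adj i {a} {b} e∈ = ≤-trans (multH-pos (H i) e∈ ≈ₑ-refl) (multH≤multG i a b)

  cycleWF : ∀ {c vs} → H c ≡ cycle vs → Unique vs × 3 ≤ length vs
  cycleWF {c} H≡ = subst WF H≡ (wf c)

  cycle-edgesOf : ∀ {c vs e} → H c ≡ cycle vs → e ∈ edgesOf (H c) → e ∈ cycEdges vs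
  cycle-edgesOf H≡ = subst (λ P → _ ∈ edgesOf P) H≡

  cycle-edgesOf⁻ : ∀ {c vs e} → H c ≡ cycle vs → e ∈ cycEdges vs → e ∈ edgesOf (H c)
  cycle-edgesOf⁻ H≡ = subst (λ P → _ ∈ edgesOf P) (sym H≡)

  cycle-vertsOf : ∀ {c vs z} → H c ≡ cycle vs → z ∈ vertsOf (H c) → z ∈ vs
  cycle-vertsOf H≡ = subst (λ P → _ ∈ vertsOf P) H≡

  cycle-vertsOf⁻ : ∀ {c vs z} → H c ≡ cycle vs → z ∈ vs → z ∈ vertsOf (H c)
  cycle-vertsOf⁻ H≡ = subst (λ P → _ ∈ vertsOf P) (sym H≡)

  cycle⇒Adj : ∀ {c vs a b} → H c ≡ cycle vs → (a , b) ∈ cycEdges vs → Adj a b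
  cycle⇒Adj {c} H≡ e∈ = edgesOf⇒Adj c (cycle-edgesOf⁻ H≡ e∈)

  edgesOf-irrefl : ∀ i {a b} → (a , b) ∈ edgesOf (H i) → a ≢ b
  edgesOf-irrefl i e∈ with H i | wf i
  ... | dbl u w   | u≢w = λ { refl → u≢w (dbl-loop e∈) }
    where dbl-loop : ∀ {a u w} → (a , a) ∈ (u , w) ∷ (u , w) ∷ [] → u ≡ w
          dbl-loop (here refl)         = refl
          dbl-loop (there (here refl)) = refl
  ... | cycle vs  | vs! , len≥3 = cycEdges-irrefl vs! (≤-trans (n≤1+n 2) len≥3) e∈

  Adj-irrefl : ∀ {a b} → Adj a b → a ≢ b
  Adj-irrefl {a} {b} adj with multG-pos⇒∃ adj
  ... | i , pos with multH-pos⇒∃ (H i) pos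
  ...   | _ , e∈ , inj₁ (refl , refl) = edgesOf-irrefl i e∈
  ...   | _ , e∈ , inj₂ (refl , refl) = λ a≡b → edgesOf-irrefl i e∈ (sym a≡b)

  Reach-trans : ∀ {x y z} → Reach x y → Reach y z → Reach x z
  Reach-trans here           y↝z = y↝z
  Reach-trans (step adj x↝y) y↝z = step adj (Reach-trans x↝y y↝z)

  Reach-snoc : ∀ {x y z} → Reach x y → Adj y z → Reach x z
  Reach-snoc x↝y adj = Reach-trans x↝y (step adj here)

  Reach-sym : ∀ {x y} → Reach x y → Reach y x
  Reach-sym here           = here
  Reach-sym (step adj x↝y) = Reach-snoc (Reach-sym x↝y) (Adj-sym adj)

  Closed : List V → Set
  Closed S = ∀ {a b} → Adj a b → a ∈ S → b ∈ S

  Closed-Reach : ∀ {S} → Closed S → ∀ {x y} → Reach x y → x ∈ S → y ∈ S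
  Closed-Reach S-closed here           x∈S = x∈S
  Closed-Reach S-closed (step adj x↝y) x∈S = Closed-Reach S-closed x↝y (S-closed adj x∈S)

  Closed-Reach⁻ : ∀ {S} → Closed S → ∀ {x y} → Reach x y → y ∈ S → x ∈ S
  Closed-Reach⁻ S-closed x↝y = Closed-Reach S-closed (Reach-sym x↝y)

  Closed-cycle : ∀ {S c vs} → Closed S → H c ≡ cycle vs → ∀ {a b} → a ∈ vs → b ∈ vs → a ∈ S → b ∈ S
  Closed-cycle S-closed H≡ = cycEdges-transport (_∈ _)
    (λ e∈ → S-closed (cycle⇒Adj H≡ e∈) , S-closed (Adj-sym (cycle⇒Adj H≡ e∈)))

-- Growing components from cycles

module Spanning {n k : ℕ} (H : Fin k → Piece n) (wf : ∀ i → WF (H i)) where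

  open Graph H wf public

  private
    V : Set
    V = Fin n

  pairs-unique : Unique pairs
  pairs-unique = Unique.filter⁺ (λ p → proj₁ p FinP.<? proj₂ p) (Unique.cartesianProduct⁺ (Unique.allFin⁺ n) (Unique.allFin⁺ n))

  ∈-pairs⁺ : ∀ {a b} → a F.< b → (a , b) ∈ pairs
  ∈-pairs⁺ {a} {b} = ∈-filter⁺ (λ p → proj₁ p FinP.<? proj₂ p) (∈-cartesianProduct⁺ (∈-allFin a) (∈-allFin b))

  ∈-pairs⁻ : ∀ {p} → p ∈ pairs → proj₁ p F.< proj₂ p
  ∈-pairs⁻ p∈ = proj₂ (∈-filter⁻ (λ p → proj₁ p FinP.<? proj₂ p) {xs = cartesianProduct (allFin n) (allFin n)} p∈)

  support : List (V × V)
  support = filter (λ p → Adj? (proj₁ p) (proj₂ p)) pairs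


  ∈-support⁻ : ∀ {p} → p ∈ support → p ∈ pairs × Adj (proj₁ p) (proj₂ p)
  ∈-support⁻ = ∈-filter⁻ (λ p → Adj? (proj₁ p) (proj₂ p))

  multG-≈ₑ : ∀ {e f} → e ≈ₑ f → multG (proj₁ e) (proj₂ e) ≡ multG (proj₁ f) (proj₂ f)
  multG-≈ₑ (inj₁ (refl , refl)) = refl
  multG-≈ₑ {a , b} (inj₂ (refl , refl)) = multG-sym a b

  Adj-≈ₑ : ∀ {e f} → e ≈ₑ f → Adj (proj₁ f) (proj₂ f) → Adj (proj₁ e) (proj₂ e)
  Adj-≈ₑ e≈f = subst (0 <_) (sym (multG-≈ₑ e≈f))

  canon-∈-support : ∀ {u w} → Adj u w → canon (u , w) ∈ support
  canon-∈-support adj = ∈-filter⁺ (λ p → Adj? (proj₁ p) (proj₂ p))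
    (∈-pairs⁺ (canon-< (Adj-irrefl adj))) (Adj-≈ₑ (canon-≈ₑ _) adj)

  record Covering (S : List V) (A : List (V × V)) : Set where
    field
      S-unique   : Unique S
      A-unique   : Unique A
      A⊆support  : A ⊆ support
      A-within-S : ∀ {p} → p ∈ A → proj₁ p ∈ S × proj₂ p ∈ S
      |S|≤|A|    : length S ≤ length A

  open Covering public

  covering-[] : Covering [] []
  covering-[] = record { S-unique = [] ; A-unique = [] ; A⊆support = λ () ; A-within-S = λ () ; |S|≤|A| = z≤n }

  covering-edge : ∀ {S A u w} → Covering S A → Adj u w → u ∈ S → w ∉ S → Covering (w ∷ S) (canon (u , w) ∷ A)
  covering-edge {S} {A} {u} {w} cov adj u∈S w∉S = record
    { S-unique   = unique-∷ w∉S (S-unique cov)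
    ; A-unique   = unique-∷ fresh (A-unique cov)
    ; A⊆support  = λ { (here refl) → canon-∈-support adj ; (there p∈) → A⊆support cov p∈ }
    ; A-within-S = within
    ; |S|≤|A|    = s≤s (|S|≤|A| cov) }
    where
      fresh : canon (u , w) ∉ A
      fresh p∈ = w∉S (proj₂ (≈ₑ-endpoints {P = _∈ S} (≈ₑ-sym (canon-≈ₑ (u , w))) (A-within-S cov p∈)))
      within : ∀ {p} → p ∈ canon (u , w) ∷ A → proj₁ p ∈ w ∷ S × proj₂ p ∈ w ∷ S
      within (here refl) = ≈ₑ-endpoints {P = _∈ w ∷ S} (canon-≈ₑ (u , w)) (there u∈S , here refl)
      within (there p∈)  = let (a∈ , b∈) = A-within-S cov p∈ in there a∈ , there b∈

  covering-cycle : ∀ {S A c vs} → Covering S A → H c ≡ cycle vs → Disjoint vs S →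
    Covering (vs ++ S) (map canon (cycEdges vs) ++ A)
  covering-cycle {S} {A} {c} {vs} cov H≡ vs#S = record
    { S-unique   = Unique.++⁺ vs! (S-unique cov) vs#S
    ; A-unique   = Unique.++⁺ (cycEdges-canon-unique vs! len≥3) (A-unique cov) cycle#A
    ; A⊆support  = ⊆support
    ; A-within-S = within
    ; |S|≤|A|    = subst₂ _≤_ (sym (length-++ vs)) (sym (length-++ (map canon (cycEdges vs))))
                     (+-mono-≤ (≤-reflexive (sym |cycle|≡)) (|S|≤|A| cov)) }
    where
      vs! : Unique vs
      vs! = proj₁ (cycleWF H≡)
      len≥3 : 3 ≤ length vs
      len≥3 = proj₂ (cycleWF H≡)
      |cycle|≡ : length (map canon (cycEdges vs)) ≡ length vs
      |cycle|≡ = trans (length-map canon (cycEdges vs)) (length-cycEdges vs)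
      canon-cycle-within : ∀ {p} → p ∈ map canon (cycEdges vs) → proj₁ p ∈ vs × proj₂ p ∈ vs
      canon-cycle-within p∈ with ∈-map⁻ canon p∈
      ... | e , e∈ , refl = ≈ₑ-endpoints {P = _∈ vs} (canon-≈ₑ e) (∈-cycEdges⇒∈₁ e∈ , ∈-cycEdges⇒∈₂ e∈)
      cycle#A : Disjoint (map canon (cycEdges vs)) A
      cycle#A (p∈cycle , p∈A) = vs#S (proj₁ (canon-cycle-within p∈cycle) , proj₁ (A-within-S cov p∈A))
      ⊆support : map canon (cycEdges vs) ++ A ⊆ support
      ⊆support p∈ with ∈-++⁻ (map canon (cycEdges vs)) p∈
      ... | inj₂ p∈A = A⊆support cov p∈A
      ... | inj₁ p∈cycle with ∈-map⁻ canon p∈cycle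
      ...   | e , e∈ , refl = canon-∈-support (cycle⇒Adj H≡ e∈)
      within : ∀ {p} → p ∈ map canon (cycEdges vs) ++ A → proj₁ p ∈ vs ++ S × proj₂ p ∈ vs ++ S
      within p∈ with ∈-++⁻ (map canon (cycEdges vs)) p∈
      ... | inj₁ p∈cycle = let (a∈ , b∈) = canon-cycle-within p∈cycle in ∈-++⁺ˡ a∈ , ∈-++⁺ˡ b∈
      ... | inj₂ p∈A     = let (a∈ , b∈) = A-within-S cov p∈A in ∈-++⁺ʳ vs a∈ , ∈-++⁺ʳ vs b∈

  data Growth : List V → List V → List (V × V) → Set where
    stop : ∀ {S} → Growth S S []
    add  : ∀ {S S′ es} u w → Adj u w → u ∈ S → w ∉ S → Growth (w ∷ S) S′ es → Growth S S′ ((u , w) ∷ es)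

  Growth-⊆ : ∀ {S S′ es} → Growth S S′ es → S ⊆ S′
  Growth-⊆ stop                   x∈S = x∈S
  Growth-⊆ (add _ _ _ _ _ growth) x∈S = Growth-⊆ growth (there x∈S)

  Growth-length : ∀ {S S′ es} → Growth S S′ es → length S ≤ length S′
  Growth-length stop                   = ≤-refl
  Growth-length (add _ _ _ _ _ growth) = ≤-trans (n≤1+n _) (Growth-length growth)

  Growth-Adj : ∀ {S S′ es} → Growth S S′ es → ∀ {e} → e ∈ es → Adj (proj₁ e) (proj₂ e)
  Growth-Adj (add _ _ adj _ _ _)    (here refl) = adj
  Growth-Adj (add _ _ _ _ _ growth) (there e∈)  = Growth-Adj growth e∈

  Growth-new : ∀ {S S′ es} → Growth S S′ es → ∀ {e} → e ∈ es → proj₂ e ∉ S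
  Growth-new (add _ _ _ _ w∉S _)    (here refl) = w∉S
  Growth-new (add _ _ _ _ _ growth) (there e∈)  = Growth-new growth e∈ ∘ there

  Growth-within : ∀ {S S′ es} → Growth S S′ es → ∀ {e} → e ∈ es → proj₁ e ∈ S′ × proj₂ e ∈ S′
  Growth-within (add _ _ _ u∈S _ growth) (here refl) = Growth-⊆ growth (there u∈S) , Growth-⊆ growth (here refl)
  Growth-within (add _ _ _ _ _ growth)   (there e∈)  = Growth-within growth e∈

  Growth-avoids-closed : ∀ {S S′ es S₀} → Growth S S′ es → Closed S₀ → S₀ ⊆ S →
    ∀ {e} → e ∈ es → proj₁ e ∉ S₀ × proj₂ e ∉ S₀
  Growth-avoids-closed (add _ _ adj _ w∉S _) S₀-closed S₀⊆S (here refl) =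
    (λ u∈S₀ → w∉S (S₀⊆S (S₀-closed adj u∈S₀))) , w∉S ∘ S₀⊆S
  Growth-avoids-closed (add _ _ _ _ _ growth) S₀-closed S₀⊆S (there e∈) =
    Growth-avoids-closed growth S₀-closed (there ∘ S₀⊆S) e∈

  Linked : List V → List (V × V) → V → V → Set
  Linked S es z q = (z ∈ S × q ∈ S) ⊎ (∃ λ e → e ∈ es × e ≈ₑ (z , q))

  -- The vertex w added by the first step is linked to the rest only through its own tree
  -- edge (u , w), so it cannot have two distinct linked neighbours.
  Growth-core⊆base : ∀ {S S′ es} → Growth S S′ es → (P : V → Set) → (∀ {z} → P z → z ∈ S′) →
    (∀ {z} → P z → ∃₂ λ q₁ q₂ → q₁ ≢ q₂ × P q₁ × P q₂ × Linked S es z q₁ × Linked S es z q₂) →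
    ∀ {z} → P z → z ∈ S
  Growth-core⊆base stop P P⊆S′ _ Pz = P⊆S′ Pz
  Growth-core⊆base {S} {S′} {(u , w) ∷ es} (add u w _ u∈S w∉S growth) P P⊆S′ two-links {z} Pz = P⊆S (P⊆w∷S Pz)
    where
      shift : ∀ {z q} → Linked S ((u , w) ∷ es) z q → Linked (w ∷ S) es z q
      shift (inj₁ (z∈S , q∈S))        = inj₁ (there z∈S , there q∈S)
      shift (inj₂ (_ , here refl , uw≈zq)) = inj₁ (≈ₑ-endpoints {P = _∈ w ∷ S} (≈ₑ-sym uw≈zq) (there u∈S , here refl))
      shift (inj₂ (e , there e∈ , e≈zq))   = inj₂ (e , e∈ , e≈zq)
      P⊆w∷S : ∀ {z} → P z → z ∈ w ∷ S
      P⊆w∷S = Growth-core⊆base growth P P⊆S′ λ Pz →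
        let (q₁ , q₂ , q₁≢q₂ , Pq₁ , Pq₂ , l₁ , l₂) = two-links Pz in q₁ , q₂ , q₁≢q₂ , Pq₁ , Pq₂ , shift l₁ , shift l₂
      only-u : ∀ {q} → P q → Linked S ((u , w) ∷ es) w q → q ≡ u
      only-u _  (inj₁ (w∈S , _))                        = ⊥-elim (w∉S w∈S)
      only-u _  (inj₂ (_ , here refl , inj₁ (u≡w , _))) = ⊥-elim (w∉S (subst (_∈ S) u≡w u∈S))
      only-u _  (inj₂ (_ , here refl , inj₂ (u≡q , _))) = sym u≡q
      only-u Pq (inj₂ (e , there e∈ , e≈wq)) =
        ⊥-elim (Growth-new growth e∈ (proj₂ (≈ₑ-endpoints {P = _∈ w ∷ S} e≈wq (here refl , P⊆w∷S Pq))))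
      P⊆S : z ∈ w ∷ S → z ∈ S
      P⊆S (there z∈S) = z∈S
      P⊆S (here refl) with two-links Pz
      ... | q₁ , q₂ , q₁≢q₂ , Pq₁ , Pq₂ , l₁ , l₂ = ⊥-elim (q₁≢q₂ (trans (only-u Pq₁ l₁) (sym (only-u Pq₂ l₂))))

  record Closure (S : List V) (A : List (V × V)) : Set where
    field
      S′        : List V
      A′        : List (V × V)
      tree      : List (V × V)
      covering′ : Covering S′ A′
      closed′   : Closed S′
      growth    : Growth S S′ tree
      A′-new    : ∀ {p} → p ∈ A′ → p ∈ A ⊎ ∃ λ e → e ∈ tree × p ≡ canon e

  private
    crossing? : ∀ S → Dec (∃ λ u → ∃ λ w → Adj u w × u ∈ S × w ∉ S)
    crossing? S = FinP.any? (λ u → FinP.any? (λ w → Adj? u w ×-dec (u ∈? S) ×-dec ¬? (w ∈? S)))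

    trivial-closure : ∀ {S A} → Covering S A → Closed S → Closure S A
    trivial-closure cov S-closed =
      record { S′ = _ ; A′ = _ ; tree = [] ; covering′ = cov ; closed′ = S-closed ; growth = stop ; A′-new = inj₁ }

  -- Recursion on fuel: when it runs out, n ≤ length S and S lists every vertex.
  close : ∀ fuel {S A} → n ≤ fuel + length S → Covering S A → Closure S A
  close zero          n≤|S| cov = trivial-closure cov (λ {_} {b} _ _ → unique-length≥n⇒∈ (S-unique cov) n≤|S| b)
  close (suc fuel) {S} {A} n≤ cov with crossing? S
  ... | no no-crossing = trivial-closure cov S-closed
    where
      S-closed : Closed S
      S-closed {a} {b} adj a∈S with b ∈? S
      ... | yes b∈S = b∈S
      ... | no b∉S  = ⊥-elim (no-crossing (a , b , adj , a∈S , b∉S))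
  ... | yes (u , w , adj , u∈S , w∉S) = record
    { S′ = S′ ; A′ = A′ ; tree = (u , w) ∷ tree ; covering′ = covering′ ; closed′ = closed′
    ; growth = add u w adj u∈S w∉S growth ; A′-new = new }
    where
      open Closure (close fuel (subst (n ≤_) (sym (+-suc fuel _)) n≤) (covering-edge cov adj u∈S w∉S))
      new : ∀ {p} → p ∈ A′ → p ∈ A ⊎ ∃ λ e → e ∈ (u , w) ∷ tree × p ≡ canon e
      new p∈ with A′-new p∈
      ... | inj₁ (here refl)         = inj₂ ((u , w) , here refl , refl)
      ... | inj₁ (there p∈A)         = inj₁ p∈A
      ... | inj₂ (e , e∈ , p≡canon) = inj₂ (e , there e∈ , p≡canon)

  record Exhaustion (S₀ S : List V) (A : List (V × V)) : Set where
    field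
      Sᶠ        : List V
      Aᶠ        : List (V × V)
      coveringᶠ : Covering Sᶠ Aᶠ
      InG⇒∈Sᶠ   : ∀ x → InG x → x ∈ Sᶠ
      Aᶠ-new    : ∀ {p} → p ∈ Aᶠ → p ∈ A ⊎ (proj₁ p ∉ S₀ × proj₂ p ∉ S₀)

  canon-avoids : ∀ {X : List V} e → proj₁ e ∉ X × proj₂ e ∉ X → proj₁ (canon e) ∉ X × proj₂ (canon e) ∉ X
  canon-avoids e = ≈ₑ-endpoints {P = _∉ _} (canon-≈ₑ e)

  InG? : ∀ x → Dec (InG x)
  InG? x = FinP.any? (λ i → x ∈? vertsOf (H i))

  module _ (every-comp-has-cycle : EveryCompHasCycle) where

    exhaust : ∀ fuel {S₀ S A} → n ≤ fuel + length S → Covering S A → Closed S → Closed S₀ → S₀ ⊆ S →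
      Exhaustion S₀ S A
    exhaust zero n≤|S| cov _ _ _ = record
      { Sᶠ = _ ; Aᶠ = _ ; coveringᶠ = cov ; InG⇒∈Sᶠ = λ x _ → unique-length≥n⇒∈ (S-unique cov) n≤|S| x ; Aᶠ-new = inj₁ }
    exhaust (suc fuel) {S₀} {S} {A} n≤ cov S-closed S₀-closed S₀⊆S
      with FinP.any? (λ x → InG? x ×-dec ¬? (x ∈? S))
    ... | no none-outside = record { Sᶠ = S ; Aᶠ = A ; coveringᶠ = cov ; InG⇒∈Sᶠ = InG⇒∈S ; Aᶠ-new = inj₁ }
      where
        InG⇒∈S : ∀ x → InG x → x ∈ S
        InG⇒∈S x x∈G with x ∈? S
        ... | yes x∈S = x∈S
        ... | no x∉S  = ⊥-elim (none-outside (x , x∈G , x∉S))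
    ... | yes (x , x∈G , x∉S) with every-comp-has-cycle x x∈G
    ...   | c , is-cycle , y , y∈Hc , x↝y with H c in H≡ | is-cycle
    ...     | cycle (v ∷ t) | _ = record
      { Sᶠ = Sᶠ ; Aᶠ = Aᶠ ; coveringᶠ = coveringᶠ ; InG⇒∈Sᶠ = InG⇒∈Sᶠ ; Aᶠ-new = new }
      where
        vs : List V
        vs = v ∷ t
        vs#S : Disjoint vs S
        vs#S (z∈vs , z∈S) = x∉S (Closed-Reach⁻ S-closed x↝y (Closed-cycle S-closed H≡ z∈vs y∈Hc z∈S))
        open Closure (close n (m≤m+n n _) (covering-cycle cov H≡ vs#S))
        S₀⊆vs++S : S₀ ⊆ vs ++ S
        S₀⊆vs++S = ∈-++⁺ʳ vs ∘ S₀⊆S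
        |S|<|S′| : suc (length S) ≤ length S′
        |S|<|S′| = ≤-trans (s≤s (m≤n+m (length S) (length t))) (≤-trans (≤-reflexive (sym (length-++ vs))) (Growth-length growth))
        open Exhaustion (exhaust fuel (≤-trans n≤ (≤-trans (≤-reflexive (sym (+-suc fuel (length S)))) (+-monoʳ-≤ fuel |S|<|S′|)))
                           covering′ closed′ S₀-closed (Growth-⊆ growth ∘ S₀⊆vs++S))
        new : ∀ {p} → p ∈ Aᶠ → p ∈ A ⊎ (proj₁ p ∉ S₀ × proj₂ p ∉ S₀)
        new p∈ with Aᶠ-new p∈
        ... | inj₂ avoids = inj₂ avoids
        ... | inj₁ p∈A′ with A′-new p∈A′
        ...   | inj₂ (e , e∈ , refl) = inj₂ (canon-avoids e (Growth-avoids-closed growth S₀-closed S₀⊆vs++S e∈))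
        ...   | inj₁ p∈ with ∈-++⁻ (map canon (cycEdges vs)) p∈
        ...     | inj₂ p∈A = inj₁ p∈A
        ...     | inj₁ p∈cycle with ∈-map⁻ canon p∈cycle
        ...       | e , e∈ , refl = inj₂ (canon-avoids e
                      ( (λ a∈S₀ → vs#S (∈-cycEdges⇒∈₁ e∈ , S₀⊆S a∈S₀))
                      , (λ b∈S₀ → vs#S (∈-cycEdges⇒∈₂ e∈ , S₀⊆S b∈S₀))))

-- Counting

2[0<m]≤m+[m≡1] : ∀ m → indicator (0 <? m) + indicator (0 <? m) ≤ m + indicator (m ℕ.≟ 1)
2[0<m]≤m+[m≡1] zero          = z≤n
2[0<m]≤m+[m≡1] (suc zero)    = ≤-refl
2[0<m]≤m+[m≡1] (suc (suc m)) = s≤s (s≤s z≤n)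

m+[m≡1]≤2[0<m]⇒m≤2 : ∀ m → m + indicator (m ℕ.≟ 1) ≤ indicator (0 <? m) + indicator (0 <? m) → m ≤ 2
m+[m≡1]≤2[0<m]⇒m≤2 zero          _       = z≤n
m+[m≡1]≤2[0<m]⇒m≤2 (suc zero)    _       = s≤s z≤n
m+[m≡1]≤2[0<m]⇒m≤2 (suc (suc m)) m+ind≤2 = ≤-trans (m≤m+n _ _) m+ind≤2

module Counting {n k : ℕ} (H : Fin k → Piece n) (wf : ∀ i → WF (H i)) where

  open Spanning H wf public

  private
    V : Set
    V = Fin n

  vG≤length : ∀ {S} → (∀ x → InG x → x ∈ S) → vG ≤ length S
  vG≤length InG⊆S = length-mono-⊆ FinP._≟_ (Unique.filter⁺ _ (Unique.allFin⁺ n))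
    (λ x∈ → InG⊆S _ (satisfied (proj₂ (∈-filter⁻ (λ x → any? (λ i → x ∈? vertsOf (H i)) (allFin k)) {xs = allFin n} x∈))))

  Covering⇒length≤ : ∀ {S A} → Covering S A → length A ≤ length support
  Covering⇒length≤ cov = length-mono-⊆ (≡-dec FinP._≟_ FinP._≟_) (A-unique cov) (A⊆support cov)

  private
    mult : V × V → ℕ
    mult p = multG (proj₁ p) (proj₂ p)

    occupied : V × V → ℕ
    occupied p = indicator (Adj? (proj₁ p) (proj₂ p))

    double : V × V → ℕ
    double p = occupied p + occupied p

    weight : V × V → ℕ
    weight p = mult p + indicator (mult p ℕ.≟ 1)

    sum-double : sum (map double pairs) ≡ 2 * length support
    sum-double = begin
      sum (map double pairs)                                ≡⟨ sum-map-+ occupied occupied pairs ⟩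
      sum (map occupied pairs) + sum (map occupied pairs)   ≡⟨ cong₂ _+_ |support|≡ (trans |support|≡ (sym (+-identityʳ _))) ⟩
      2 * length support                                    ∎
      where
        open ≡-Reasoning
        |support|≡ : sum (map occupied pairs) ≡ length support
        |support|≡ = sym (length-filter≡sum (λ p → Adj? (proj₁ p) (proj₂ p)) pairs)

    sum-weight : sum (map weight pairs) ≡ eG + eSing
    sum-weight = trans (sum-map-+ mult (λ p → indicator (mult p ℕ.≟ 1)) pairs)
                       (cong (eG +_) (sym (length-filter≡sum (λ p → mult p ℕ.≟ 1) pairs)))

  2|support|≤eG+eSing : 2 * length support ≤ eG + eSing
  2|support|≤eG+eSing = subst₂ _≤_ sum-double sum-weight (sum-map-mono double weight pairs (λ {p} _ → 2[0<m]≤m+[m≡1] (mult p)))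

  eG+eSing≤2|support|⇒multG≤2 : eG + eSing ≤ 2 * length support → ∀ {a b} → (a , b) ∈ pairs → multG a b ≤ 2
  eG+eSing≤2|support|⇒multG≤2 tight {a} {b} p∈ = m+[m≡1]≤2[0<m]⇒m≤2 (multG a b)
    (sum-map-mono-tight double weight pairs (λ {p} _ → 2[0<m]≤m+[m≡1] (mult p)) (subst₂ _≤_ (sym sum-weight) (sym sum-double) tight) p∈)

  count-≈ₑ-pairs : ∀ {a b : V} → a ≢ b → length (filter ((a , b) ≈ₑ?_) pairs) ≡ 1
  count-≈ₑ-pairs {a} {b} a≢b = unique-constant⇒length≡1 (Unique.filter⁺ _ pairs-unique) all-canon canon∈
    where
      all-canon : ∀ {p} → p ∈ filter ((a , b) ≈ₑ?_) pairs → p ≡ canon (a , b)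
      all-canon p∈ with ∈-filter⁻ ((a , b) ≈ₑ?_) {xs = pairs} p∈
      ... | p∈pairs , ab≈p = trans (sym (canon-fixed (∈-pairs⁻ p∈pairs))) (≈ₑ⇒canon-≡ (≈ₑ-sym ab≈p))
      canon∈ : canon (a , b) ∈ filter ((a , b) ≈ₑ?_) pairs
      canon∈ = ∈-filter⁺ ((a , b) ≈ₑ?_) (∈-pairs⁺ (canon-< a≢b)) (≈ₑ-sym (canon-≈ₑ (a , b)))

  length-edgesOf : ∀ (P : Piece n) → length (edgesOf P) ≡ length (vertsOf P)
  length-edgesOf (cycle vs) = length-cycEdges vs
  length-edgesOf (dbl _ _)  = refl

  sum-multH≡length-vertsOf : ∀ i → sum (map (λ p → multH (H i) (proj₁ p) (proj₂ p)) pairs) ≡ length (vertsOf (H i))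
  sum-multH≡length-vertsOf i = begin
    sum (map (λ p → multH (H i) (proj₁ p) (proj₂ p)) pairs)
      ≡⟨ sum-map-cong _ _ pairs (λ {p} _ → length-filter≡sum (_≈ₑ? p) (edgesOf (H i))) ⟩
    sum (map (λ p → sum (map (λ e → indicator (e ≈ₑ? p)) (edgesOf (H i)))) pairs)
      ≡⟨ sum-map-comm (λ p e → indicator (e ≈ₑ? p)) pairs (edgesOf (H i)) ⟩
    sum (map (λ e → sum (map (λ p → indicator (e ≈ₑ? p)) pairs)) (edgesOf (H i)))
      ≡⟨ sum-map-cong _ _ (edgesOf (H i)) (λ e∈ → trans (sym (length-filter≡sum (_ ≈ₑ?_) pairs))
                                                         (count-≈ₑ-pairs (edgesOf-irrefl i e∈))) ⟩
    sum (map (λ _ → 1) (edgesOf (H i)))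
      ≡⟨ length≡sum-const (edgesOf (H i)) ⟨
    length (edgesOf (H i))
      ≡⟨ length-edgesOf (H i) ⟩
    length (vertsOf (H i)) ∎
    where open ≡-Reasoning

  sumV≡eG : sumV ≡ eG
  sumV≡eG = begin
    sumV
      ≡⟨ sum-map-cong _ _ (allFin k) (λ {i} _ → sym (sum-multH≡length-vertsOf i)) ⟩
    sum (map (λ i → sum (map (λ p → multH (H i) (proj₁ p) (proj₂ p)) pairs)) (allFin k))
      ≡⟨ sum-map-comm (λ i p → multH (H i) (proj₁ p) (proj₂ p)) (allFin k) pairs ⟩
    eG ∎
    where open ≡-Reasoning

  module _ (every-comp-has-cycle : EveryCompHasCycle) where

    full-exhaustion : Exhaustion [] [] []
    full-exhaustion = exhaust every-comp-has-cycle n (m≤m+n n 0) covering-[] (λ _ ()) (λ _ ()) (λ ())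

    vG≤|support| : vG ≤ length support
    vG≤|support| = ≤-trans (vG≤length InG⇒∈Sᶠ) (≤-trans (|S|≤|A| coveringᶠ) (Covering⇒length≤ coveringᶠ))
      where open Exhaustion full-exhaustion

-- The equality case

pos⇔pos∧m+n≤2⇒m≡n : ∀ m n → (0 < m → 0 < n) → (0 < n → 0 < m) → (0 < m → m + n ≤ 2) → m ≡ n
pos⇔pos∧m+n≤2⇒m≡n zero          zero          _   _   _     = refl
pos⇔pos∧m+n≤2⇒m≡n zero          (suc _)       _   n⇒m _     with n⇒m (s≤s z≤n)
... | ()
pos⇔pos∧m+n≤2⇒m≡n (suc _)       zero          m⇒n _   _     with m⇒n (s≤s z≤n)
... | ()
pos⇔pos∧m+n≤2⇒m≡n (suc zero)    (suc zero)    _   _   _     = refl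
pos⇔pos∧m+n≤2⇒m≡n (suc zero)    (suc (suc _)) _   _   bound with bound (s≤s z≤n)
... | s≤s (s≤s ())
pos⇔pos∧m+n≤2⇒m≡n (suc (suc m)) (suc n)       _   _   bound with bound (s≤s z≤n)
... | s≤s (s≤s m+1+n≤0) with subst (_≤ 0) (+-suc m n) m+1+n≤0
...   | ()

module Equality {n k : ℕ} (H : Fin k → Piece n) (wf : ∀ i → WF (H i))
  (every-comp-has-cycle : Overlay.EveryCompHasCycle H)
  (equality : 2 * Overlay.vG H ≡ Overlay.sumV H + Overlay.eSing H) where

  open Counting H wf

  private
    V : Set
    V = Fin n

  2vG≡eG+eSing : 2 * vG ≡ eG + eSing
  2vG≡eG+eSing = trans equality (cong (_+ eSing) sumV≡eG)

  |support|≤vG : length support ≤ vG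
  |support|≤vG = *-cancelˡ-≤ 2 (≤-trans 2|support|≤eG+eSing (≤-reflexive (sym 2vG≡eG+eSing)))

  eG+eSing≤2|support| : eG + eSing ≤ 2 * length support
  eG+eSing≤2|support| = subst (_≤ 2 * length support) 2vG≡eG+eSing (*-monoʳ-≤ 2 (vG≤|support| every-comp-has-cycle))

  multG≤2 : ∀ {a b} → a ≢ b → multG a b ≤ 2
  multG≤2 {a} {b} a≢b = subst (_≤ 2) (multG-≈ₑ (canon-≈ₑ (a , b)))
    (eG+eSing≤2|support|⇒multG≤2 eG+eSing≤2|support| (∈-pairs⁺ (canon-< a≢b)))

  covering-complete : ∀ {S A} → Covering S A → (∀ x → InG x → x ∈ S) → ∀ {a b} → Adj a b → canon (a , b) ∈ A
  covering-complete cov InG⊆S adj = ⊆-length-≥⇒⊇ (≡-dec FinP._≟_ FinP._≟_) (A-unique cov) (A⊆support cov)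
    (≤-trans |support|≤vG (≤-trans (vG≤length InG⊆S) (|S|≤|A| cov))) (canon-∈-support adj)

  module Component (x : V) (c : Fin k) (vs : List V) (H≡ : H c ≡ cycle vs)
                   (y : V) (y∈vs : y ∈ vs) (x↝y : Reach x y) where

    vs! : Unique vs
    vs! = proj₁ (cycleWF H≡)

    base : Covering vs (map canon (cycEdges vs))
    base = subst₂ Covering (++-identityʳ vs) (++-identityʳ _) (covering-cycle covering-[] H≡ λ ())

    open Closure (close n (m≤m+n n _) base) renaming (S′ to S₁)
    open Exhaustion (exhaust every-comp-has-cycle n (m≤m+n n _) covering′ closed′ closed′ id)

    -- By equality the final covering contains every edge of G, and an edge at S₁ cannot have
    -- been added after S₁, which is closed.
    Adj⇒cycle-or-tree : ∀ {a b} → Adj a b → a ∈ S₁ →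
      (∃ λ e → e ∈ cycEdges vs × e ≈ₑ (a , b)) ⊎ (∃ λ e → e ∈ tree × e ≈ₑ (a , b))
    Adj⇒cycle-or-tree {a} {b} adj a∈S₁ with Aᶠ-new (covering-complete coveringᶠ InG⇒∈Sᶠ adj)
    ... | inj₂ avoids = ⊥-elim (proj₁ (≈ₑ-endpoints {P = _∉ S₁} (≈ₑ-sym (canon-≈ₑ (a , b))) avoids) a∈S₁)
    ... | inj₁ p∈A′ with A′-new p∈A′
    ...   | inj₂ (e , e∈ , canon≡) = inj₂ (e , e∈ , canon-≡⇒≈ₑ (sym canon≡))
    ...   | inj₁ p∈cycle with ∈-map⁻ canon p∈cycle
    ...     | e , e∈ , canon≡ = inj₁ (e , e∈ , canon-≡⇒≈ₑ (sym canon≡))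

    Linked-at : ∀ {a q} → a ∈ S₁ → Adj a q → Linked vs tree a q
    Linked-at a∈S₁ adj with Adj⇒cycle-or-tree adj a∈S₁
    ... | inj₁ (e , e∈ , e≈) = inj₁ (≈ₑ-endpoints {P = _∈ vs} (≈ₑ-sym e≈) (∈-cycEdges⇒∈₁ e∈ , ∈-cycEdges⇒∈₂ e∈))
    ... | inj₂ tree-edge     = inj₂ tree-edge

    Reach-within-cycle : ∀ {z} → z ∈ vs → Reach y z
    Reach-within-cycle z∈ = cycEdges-transport (Reach y)
      (λ e∈ → (λ y↝ → Reach-snoc y↝ (cycle⇒Adj H≡ e∈)) , (λ y↝ → Reach-snoc y↝ (Adj-sym (cycle⇒Adj H≡ e∈))))
      y∈vs z∈ here

    Growth-Reach : ∀ {S S′ es} → Growth S S′ es → (∀ {z} → z ∈ S → Reach y z) → ∀ {z} → z ∈ S′ → Reach y z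
    Growth-Reach stop                        S↝ = S↝
    Growth-Reach (add u w adj u∈S _ growth) S↝ = Growth-Reach growth λ where
      (here refl) → Reach-snoc (S↝ u∈S) adj
      (there z∈S) → S↝ z∈S

    ∈S₁⇒Reach : ∀ {z} → z ∈ S₁ → Reach x z
    ∈S₁⇒Reach z∈ = Reach-trans x↝y (Growth-Reach growth Reach-within-cycle z∈)

    Reach⇒∈S₁ : ∀ {z} → Reach x z → z ∈ S₁
    Reach⇒∈S₁ x↝z = Closed-Reach closed′ x↝z (Closed-Reach⁻ closed′ x↝y (Growth-⊆ growth y∈vs))

    module _ {i ws z} (Hi≡ : H i ≡ cycle ws) (z∈ws : z ∈ ws) (z∈S₁ : z ∈ S₁) where

      private
        ws⊆S₁ : ws ⊆ S₁
        ws⊆S₁ b∈ = Closed-cycle closed′ Hi≡ z∈ws b∈ z∈S₁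

        two-links : ∀ {a} → a ∈ ws → ∃₂ λ q₁ q₂ → q₁ ≢ q₂ × q₁ ∈ ws × q₂ ∈ ws × Linked vs tree a q₁ × Linked vs tree a q₂
        two-links a∈ with cycEdges-two-neighbours (proj₁ (cycleWF Hi≡)) (proj₂ (cycleWF Hi≡)) a∈
        ... | q₁ , q₂ , q₁≢q₂ , e₁∈ , e₂∈ =
          q₁ , q₂ , q₁≢q₂ , ∈-cycEdges⇒∈₂ e₁∈ , ∈-cycEdges⇒∈₁ e₂∈ ,
          Linked-at (ws⊆S₁ a∈) (cycle⇒Adj Hi≡ e₁∈) , Linked-at (ws⊆S₁ a∈) (Adj-sym (cycle⇒Adj Hi≡ e₂∈))

      cycle-in-component-⊆ : ws ⊆ vs
      cycle-in-component-⊆ = Growth-core⊆base growth (_∈ ws) ws⊆S₁ two-links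

      cycle-in-component-edges : ∀ {e} → e ∈ cycEdges ws → ∃ λ e′ → e′ ∈ cycEdges vs × e′ ≈ₑ e
      cycle-in-component-edges e∈ with Adj⇒cycle-or-tree (cycle⇒Adj Hi≡ e∈) (ws⊆S₁ (∈-cycEdges⇒∈₁ e∈))
      ... | inj₁ cycle-edge = cycle-edge
      ... | inj₂ (e′ , e′∈ , e′≈) = ⊥-elim (Growth-new growth e′∈ (proj₂ (≈ₑ-endpoints {P = _∈ vs} e′≈
              (cycle-in-component-⊆ (∈-cycEdges⇒∈₁ e∈) , cycle-in-component-⊆ (∈-cycEdges⇒∈₂ e∈)))))

      private
        as-vs-adjacency : ∀ {p q} → (p , q) ∈ cycEdges ws → Adjacent (cycEdges vs) p q
        as-vs-adjacency e∈ with cycle-in-component-edges e∈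
        ... | _ , e′∈ , inj₁ (refl , refl) = inj₁ e′∈
        ... | _ , e′∈ , inj₂ (refl , refl) = inj₂ e′∈

      -- A vertex of ws has two distinct ws-neighbours, which are vs-neighbours too, and it has
      -- at most two vs-neighbours.
      vs-neighbour⇒ws-neighbour : ∀ {a b} → a ∈ ws → Adjacent (cycEdges vs) a b → Adjacent (cycEdges ws) a b
      vs-neighbour⇒ws-neighbour a∈ adj with cycEdges-two-neighbours (proj₁ (cycleWF Hi≡)) (proj₂ (cycleWF Hi≡)) a∈
      ... | q₁ , q₂ , q₁≢q₂ , e₁∈ , e₂∈
        with cycEdges-at-most-two-neighbours vs! (as-vs-adjacency e₁∈) (Adjacent-sym (as-vs-adjacency e₂∈)) adj q₁≢q₂
      ...   | inj₁ refl = inj₁ e₁∈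
      ...   | inj₂ refl = inj₂ e₂∈

      cycle-in-component-⊇ : vs ⊆ ws
      cycle-in-component-⊇ b∈ = cycEdges-transport (_∈ ws)
        (λ e∈ → (λ a∈ → Adjacent-∈₂ (vs-neighbour⇒ws-neighbour a∈ (inj₁ e∈)))
              , (λ b∈ → Adjacent-∈₂ (vs-neighbour⇒ws-neighbour b∈ (inj₂ e∈))))
        (cycle-in-component-⊆ z∈ws) b∈ z∈ws
        where
          Adjacent-∈₂ : ∀ {a b} → Adjacent (cycEdges ws) a b → b ∈ ws
          Adjacent-∈₂ (inj₁ e∈) = ∈-cycEdges⇒∈₂ e∈
          Adjacent-∈₂ (inj₂ e∈) = ∈-cycEdges⇒∈₁ e∈

      multH-cycle-pos⇒other-pos : ∀ {a b} → 0 < multH (H c) a b → 0 < multH (H i) a b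
      multH-cycle-pos⇒other-pos pos =
        let (e , e∈ , e≈ab) = multH-pos⇒∃ (H c) pos
            e∈vs = cycle-edgesOf H≡ e∈
        in ws-adjacency⇒pos e≈ab (vs-neighbour⇒ws-neighbour (cycle-in-component-⊇ (∈-cycEdges⇒∈₁ e∈vs)) (inj₁ e∈vs))
        where
          ws-adjacency⇒pos : ∀ {p q a b} → (p , q) ≈ₑ (a , b) → Adjacent (cycEdges ws) p q → 0 < multH (H i) a b
          ws-adjacency⇒pos pq≈ab (inj₁ e′∈) = multH-pos (H i) (cycle-edgesOf⁻ Hi≡ e′∈) pq≈ab
          ws-adjacency⇒pos pq≈ab (inj₂ e′∈) = multH-pos (H i) (cycle-edgesOf⁻ Hi≡ e′∈) (≈ₑ-trans ≈ₑ-swap pq≈ab)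

      multH-other-pos⇒cycle-pos : ∀ {a b} → 0 < multH (H i) a b → 0 < multH (H c) a b
      multH-other-pos⇒cycle-pos pos =
        let (e , e∈ , e≈ab) = multH-pos⇒∃ (H i) pos
            (e′ , e′∈ , e′≈e) = cycle-in-component-edges (cycle-edgesOf Hi≡ e∈)
        in multH-pos (H c) (cycle-edgesOf⁻ H≡ e′∈) (≈ₑ-trans e′≈e e≈ab)

      cycle-in-component-identical : c ≢ i → Identical c i
      cycle-in-component-identical c≢i =
        (λ z → mk⇔ (cycle-vertsOf⁻ Hi≡ ∘ cycle-in-component-⊇ ∘ cycle-vertsOf H≡)
                    (cycle-vertsOf⁻ H≡ ∘ cycle-in-component-⊆ ∘ cycle-vertsOf Hi≡)) ,
        λ a b → pos⇔pos∧m+n≤2⇒m≡n _ _ multH-cycle-pos⇒other-pos multH-other-pos⇒cycle-pos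
          (λ pos → ≤-trans (multH+multH≤multG c≢i a b) (multG≤2 (Adj-irrefl (≤-trans pos (multH≤multG c a b)))))

    no-third-cycle : ∀ {i ws z j ws′ z′} → H i ≡ cycle ws → z ∈ ws → z ∈ S₁ → H j ≡ cycle ws′ → z′ ∈ ws′ → z′ ∈ S₁ →
      c ≢ i → c ≢ j → i ≢ j → ⊥
    no-third-cycle {i} {j = j} Hi≡ z∈ z∈S₁ Hj≡ z′∈ z′∈S₁ c≢i c≢j i≢j with cycEdges-succ y∈vs
    ... | q , e∈ = <⇒≱ (≤-trans three≤ (sum-multH≤multG distinct y q)) (multG≤2 (Adj-irrefl (cycle⇒Adj H≡ e∈)))
      where
        pos : 0 < multH (H c) y q
        pos = multH-pos (H c) (cycle-edgesOf⁻ H≡ e∈) ≈ₑ-refl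
        three≤ : 3 ≤ multH (H c) y q + (multH (H i) y q + (multH (H j) y q + 0))
        three≤ = +-mono-≤ pos (+-mono-≤ (multH-cycle-pos⇒other-pos Hi≡ z∈ z∈S₁ pos)
                                        (+-mono-≤ (multH-cycle-pos⇒other-pos Hj≡ z′∈ z′∈S₁ pos) z≤n))
        distinct : Unique (c ∷ i ∷ j ∷ [])
        distinct = unique-∷ (λ { (here c≡i) → c≢i c≡i ; (there (here c≡j)) → c≢j c≡j ; (there (there ())) })
                  (unique-∷ (λ { (here i≡j) → i≢j i≡j ; (there ()) }) (unique-∷ (λ ()) []))

    DoubledAs : Fin k → V × V → Set
    DoubledAs d (u , w) = H d ≡ dbl u w ⊎ H d ≡ dbl w u

    DoubledAs⇒multH≡2 : ∀ {d e a b} → DoubledAs d e → e ≈ₑ (a , b) → multH (H d) a b ≡ 2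
    DoubledAs⇒multH≡2 (inj₁ Hd≡) e≈ = trans (cong (λ P → multH P _ _) Hd≡) (multH-dbl e≈)
    DoubledAs⇒multH≡2 (inj₂ Hd≡) e≈ = trans (cong (λ P → multH P _ _) Hd≡) (multH-dbl (≈ₑ-trans ≈ₑ-swap e≈))

    tree-edge-doubled : ∀ {e} → e ∈ tree → ∃ λ d → DoubledAs d e
    tree-edge-doubled {u , w} e∈ =
      let (i , pos) = multG-pos⇒∃ (Growth-Adj growth e∈)
          (_ , e′∈ , e′≈) = multH-pos⇒∃ (H i) pos
      in i , parallel-piece (H i) refl e′∈ e′≈
      where
        parallel-piece : ∀ {i} P → H i ≡ P → ∀ {e′} → e′ ∈ edgesOf P → e′ ≈ₑ (u , w) → DoubledAs i (u , w)
        parallel-piece (dbl _ _) Hi≡ (here refl)         (inj₁ (refl , refl)) = inj₁ Hi≡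
        parallel-piece (dbl _ _) Hi≡ (here refl)         (inj₂ (refl , refl)) = inj₂ Hi≡
        parallel-piece (dbl _ _) Hi≡ (there (here refl)) (inj₁ (refl , refl)) = inj₁ Hi≡
        parallel-piece (dbl _ _) Hi≡ (there (here refl)) (inj₂ (refl , refl)) = inj₂ Hi≡
        parallel-piece (cycle ws) Hi≡ e′∈ e′≈ =
          ⊥-elim (Growth-new growth e∈ (cycle-in-component-⊆ Hi≡ (proj₁ uw∈ws) u∈S₁ (proj₂ uw∈ws)))
          where
            u∈S₁ : u ∈ S₁
            u∈S₁ = proj₁ (Growth-within growth e∈)
            uw∈ws : u ∈ ws × w ∈ ws
            uw∈ws = ≈ₑ-endpoints {P = _∈ ws} (≈ₑ-sym e′≈) (∈-cycEdges⇒∈₁ e′∈ , ∈-cycEdges⇒∈₂ e′∈)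

    record Attachment (S : List V) (es : List (V × V)) : Set where
      field
        ds       : List (Fin k)
        attached : Attach S ds
        ds→es    : ∀ {d} → d ∈ ds → ∃ λ e → e ∈ es × DoubledAs d e
        es→ds    : ∀ {e} → e ∈ es → ∃ λ d → d ∈ ds × DoubledAs d e

    attachment : ∀ {S S′ es} → Growth S S′ es → es ⊆ tree → Attachment S es
    attachment stop _ = record { ds = [] ; attached = done ; ds→es = λ () ; es→ds = λ () }
    attachment (add u w _ u∈S w∉S growth) es⊆tree with tree-edge-doubled (es⊆tree (here refl))
    ... | d , d≅uw = record
      { ds       = d ∷ ds
      ; attached = attach-step d≅uw
      ; ds→es    = λ { (here refl) → (u , w) , here refl , d≅uw
                     ; (there d∈) → let (e , e∈ , d≅e) = ds→es d∈ in e , there e∈ , d≅e }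
      ; es→ds    = λ { (here refl) → d , here refl , d≅uw
                     ; (there e∈) → let (d′ , d′∈ , d′≅e) = es→ds e∈ in d′ , there d′∈ , d′≅e } }
      where
        open Attachment (attachment growth (es⊆tree ∘ there))
        attach-step : DoubledAs d (u , w) → Attach _ (d ∷ ds)
        attach-step (inj₁ Hd≡) = stepL d u w Hd≡ u∈S w∉S attached
        attach-step (inj₂ Hd≡) = stepR d w u Hd≡ u∈S w∉S attached


    open Attachment (attachment growth id)

    ∈ds⇒InComp : ∀ {d} → d ∈ ds → InComp x d
    ∈ds⇒InComp d∈ =
      let ((u , w) , e∈ , d≅e) = ds→es d∈
      in u , first-endpoint d≅e , ∈S₁⇒Reach (proj₁ (Growth-within growth e∈))
      where
        first-endpoint : ∀ {d u w} → DoubledAs d (u , w) → u ∈ vertsOf (H d)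
        first-endpoint (inj₁ Hd≡) = subst (λ P → _ ∈ vertsOf P) (sym Hd≡) (here refl)
        first-endpoint (inj₂ Hd≡) = subst (λ P → _ ∈ vertsOf P) (sym Hd≡) (there (here refl))

    -- A doubled edge of the component is parallel neither to an edge of the cycle nor to
    -- another doubled edge, since either would give multiplicity at least 3.
    doubled-in-component⇒∈ds : ∀ {i p q} → H i ≡ dbl p q → p ∈ S₁ → i ∈ ds
    doubled-in-component⇒∈ds {i} {p} {q} Hi≡ p∈S₁ = parallel-to (Adj⇒cycle-or-tree adj p∈S₁)
      where
        adj : Adj p q
        adj = edgesOf⇒Adj i (subst (λ P → (p , q) ∈ edgesOf P) (sym Hi≡) (here refl))
        multHᵢ≡2 : multH (H i) p q ≡ 2
        multHᵢ≡2 = trans (cong (λ P → multH P p q) Hi≡) (multH-dbl {u = p} {w = q} ≈ₑ-refl)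
        no-parallel : ∀ {j} → j ≢ i → 0 < multH (H j) p q → ⊥
        no-parallel j≢i pos = <⇒≱ (≤-trans (+-mono-≤ pos (≤-reflexive (sym multHᵢ≡2))) (multH+multH≤multG j≢i p q))
                                  (multG≤2 (Adj-irrefl adj))
        c≢i : c ≢ i
        c≢i refl with trans (sym H≡) Hi≡
        ... | ()
        same-or-parallel : ∀ {d e} → d ∈ ds → DoubledAs d e → e ≈ₑ (p , q) → Dec (d ≡ i) → i ∈ ds
        same-or-parallel d∈ _   _  (yes refl) = d∈
        same-or-parallel _  d≅e e≈ (no d≢i)   =
          ⊥-elim (no-parallel d≢i (subst (0 <_) (sym (DoubledAs⇒multH≡2 d≅e e≈)) (s≤s z≤n)))
        parallel-to : (∃ λ e → e ∈ cycEdges vs × e ≈ₑ (p , q)) ⊎ (∃ λ e → e ∈ tree × e ≈ₑ (p , q)) → i ∈ ds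
        parallel-to (inj₁ (e , e∈ , e≈)) = ⊥-elim (no-parallel c≢i (multH-pos (H c) (cycle-edgesOf⁻ H≡ e∈) e≈))
        parallel-to (inj₂ (e , e∈ , e≈)) =
          let (d , d∈ , d≅e) = es→ds e∈ in same-or-parallel d∈ d≅e e≈ (d FinP.≟ i)

    doubled-in-component⇒∈ds′ : ∀ {j z} → z ∈ vertsOf (H j) → z ∈ S₁ → ∀ {p q} → H j ≡ dbl p q → j ∈ ds
    doubled-in-component⇒∈ds′ z∈ z∈S₁ Hj≡ with subst (λ P → _ ∈ vertsOf P) Hj≡ z∈
    ... | here refl         = doubled-in-component⇒∈ds Hj≡ z∈S₁
    ... | there (here refl) = doubled-in-component⇒∈ds Hj≡
          (closed′ (Adj-sym (edgesOf⇒Adj _ (subst (λ P → _ ∈ edgesOf P) (sym Hj≡) (here refl)))) z∈S₁)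

    MeetsComponent : Fin k → Set
    MeetsComponent j = c ≢ j × IsCycle (H j) × Any (_∈ S₁) (vertsOf (H j))

    InComp-cycle : InComp x c
    InComp-cycle = y , cycle-vertsOf⁻ H≡ y∈vs , x↝y

    only-cycle : ¬ (∃ MeetsComponent) → CompStructured x
    only-cycle no-other = c ∷ [] , vs , ds , single c vs H≡ , attached , λ j → mk⇔ (to j) (from j)
      where
        to : ∀ j → InComp x j → j ∈ c ∷ [] ⊎ j ∈ ds
        to j (z , z∈ , x↝z) with piece-view (H j)
        ... | inj₂ (p , q , Hj≡) = inj₂ (doubled-in-component⇒∈ds′ z∈ (Reach⇒∈S₁ x↝z) Hj≡)
        ... | inj₁ (ws , Hj≡) with c FinP.≟ j
        ...   | yes refl = inj₁ (here refl)
        ...   | no c≢j   = ⊥-elim (no-other (j , c≢j , subst IsCycle (sym Hj≡) _ , lose z∈ (Reach⇒∈S₁ x↝z)))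
        from : ∀ j → j ∈ c ∷ [] ⊎ j ∈ ds → InComp x j
        from j (inj₁ (here refl)) = InComp-cycle
        from j (inj₂ d∈)          = ∈ds⇒InComp d∈

    two-cycles : ∀ {c′} → MeetsComponent c′ → CompStructured x
    two-cycles {c′} (c≢c′ , is-cycle , meets) =
      let (z , z∈ , z∈S₁) = find meets
          (ws , Hc′≡) = cycle-view (H c′) is-cycle
          z∈ws = cycle-vertsOf Hc′≡ z∈
      in c ∷ c′ ∷ [] , vs , ds , doubled c c′ vs c≢c′ H≡ is-cycle (cycle-in-component-identical Hc′≡ z∈ws z∈S₁ c≢c′) ,
         attached , λ j → mk⇔ (to Hc′≡ z∈ws z∈S₁ j) (from z∈ z∈S₁ j)
      where
        to : ∀ {ws z} → H c′ ≡ cycle ws → z ∈ ws → z ∈ S₁ → ∀ j → InComp x j → j ∈ c ∷ c′ ∷ [] ⊎ j ∈ ds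
        to Hc′≡ z∈ws z∈S₁ j (z′ , z′∈ , x↝z′) with piece-view (H j)
        ... | inj₂ (p , q , Hj≡) = inj₂ (doubled-in-component⇒∈ds′ z′∈ (Reach⇒∈S₁ x↝z′) Hj≡)
        ... | inj₁ (ws′ , Hj≡) with c FinP.≟ j | c′ FinP.≟ j
        ...   | yes refl | _        = inj₁ (here refl)
        ...   | no _     | yes refl = inj₁ (there (here refl))
        ...   | no c≢j   | no c′≢j  = ⊥-elim (no-third-cycle Hc′≡ z∈ws z∈S₁ Hj≡ (cycle-vertsOf Hj≡ z′∈) (Reach⇒∈S₁ x↝z′)
                                                c≢c′ c≢j c′≢j)
        from : ∀ {z} → z ∈ vertsOf (H c′) → z ∈ S₁ → ∀ j → j ∈ c ∷ c′ ∷ [] ⊎ j ∈ ds → InComp x j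
        from _  _    j (inj₁ (here refl))         = InComp-cycle
        from z∈ z∈S₁ j (inj₁ (there (here refl))) = _ , z∈ , ∈S₁⇒Reach z∈S₁
        from _  _    j (inj₂ d∈)                  = ∈ds⇒InComp d∈

    structured : CompStructured x
    structured with FinP.any? (λ j → ¬? (c FinP.≟ j) ×-dec (IsCycle? (H j) ×-dec any? (_∈? S₁) (vertsOf (H j))))
    ... | yes (c′ , meets) = two-cycles meets
    ... | no no-other      = only-cycle no-other

  component-structured : ∀ x → InG x → CompStructured x
  component-structured x x∈G =
    let (c , is-cycle , y , y∈ , x↝y) = every-comp-has-cycle x x∈G
        (vs , H≡) = cycle-view (H c) is-cycle
    in Component.structured x c vs H≡ y (cycle-vertsOf H≡ y∈) x↝y

lemma5p1 : (n k : ℕ) (H : Fin k → Piece n) → (∀ i → WF (H i))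
    → Overlay.EveryCompHasCycle H
    → (2 * Overlay.vG H ≤ Overlay.sumV H + Overlay.eSing H)
      × (Overlay.sumV H ≡ Overlay.eG H)
      × (2 * Overlay.vG H ≡ Overlay.sumV H + Overlay.eSing H
         → ∀ x → Overlay.InG H x → Overlay.CompStructured H x)
lemma5p1 n k H wf every-comp-has-cycle =
  inequality , sumV≡eG , λ equality → Equality.component-structured H wf every-comp-has-cycle equality
  where
    open Counting H wf
    inequality : 2 * vG ≤ sumV + eSing
    inequality = begin
      2 * vG             ≤⟨ *-monoʳ-≤ 2 (vG≤|support| every-comp-has-cycle) ⟩
      2 * length support ≤⟨ 2|support|≤eG+eSing ⟩
      eG + eSing         ≡⟨ cong (_+ eSing) sumV≡eG ⟨
      sumV + eSing       ∎
      where open ≤-Reasoning
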